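{- Let $n\ge1$. Then $A^c_n=\{1\}\cup\bigcup_{i=1}^n {}^iA^c_n$, and for $1\le i\le n$, $${}^iA^c_n={}^iA^c_{n-1}\cup\bigcup_{k=0}^{i-1}\big(\sigma_i\sigma_{i+1}\cdots\sigma_n\cdot{}^kA^c_{n-1}\big).$$
   Context: $W(A_n)$: Coxeter group with generators $\sigma_1,\dots,\sigma_n$ of type $A_n$; $W(A_{n-1})=\langle\sigma_1,\dots,\sigma_{n-1}\rangle\subset W(A_n)$. FC = fully commutative (reduced expressions related by commutations only). $[i,j]=\sigma_i\cdots\sigma_j$; every FC element has a unique canonical form $[i_1,j_1]\cdots[i_p,j_p]$ with $n\ge j_1>\cdots>j_p\ge1$, $n\ge i_1>\cdots>i_p\ge1$, $j_t\ge i_t$. $A^c_n$ is the set of FC elements of $W(A_n)$. For $1\le i\le n$, ${}^iA^c_n$ is the set of FC elements of $W(A_n)$ of size $p\ge1$ whose canonical form has $i_1=i$; ${}^0A^c_n=\{1\}$; ${}^iA^c_{n-1}=\emptyset$ if $i>n-1$. -}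

module Defs where

open import Data.Nat using (ℕ; zero; suc; _≤_; _<_; _≤?_)
open import Data.Nat.Properties using (≤-reflexive)
open import Data.Fin using (Fin; toℕ; inject₁; fromℕ)
open import Data.Fin.Permutation.Components using (transpose)
open import Data.Vec using (Vec; tabulate; lookup; map; _∷ʳ_)
open import Data.List using (List; []; _∷_; length; filter; allFin; concatMap)
open import Data.List.Relation.Unary.All using (All)
open import Data.Product using (_×_; _,_; ∃; Σ)
open import Data.Sum using (_⊎_)
open import Data.Unit using (⊤)
open import Relation.Nullary using (_×-dec_)
open import Relation.Binary.PropositionalEquality using (_≡_)
open import Relation.Binary.Construct.Closure.ReflexiveTransitive using (Star)
open import Data.List using (_++_)

-- Elements of W(A_n) ≅ S_{n+1} are represented as permutations of Fin (suc n),
-- stored as the vector of images g = (g(0), …, g(n)).  (Only those in the image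
-- of word evaluation, see InW, are group elements.)
Elt : ℕ → Set
Elt n = Vec (Fin (suc n)) (suc n)

one : ∀ {n} → Elt n
one = tabulate (λ x → x)

_·_ : ∀ {n} → Elt n → Elt n → Elt n
g · h = tabulate (λ x → lookup g (lookup h x))

-- letters of a word: k : Fin n stands for the generator σ_{toℕ k + 1},
-- the adjacent transposition of positions toℕ k and toℕ k + 1.
Word : ℕ → Set
Word n = List (Fin n)

σ : ∀ {n} → Fin n → Elt n
σ k = tabulate (transpose (inject₁ k) (Data.Fin.suc k))

eval : ∀ {n} → Word n → Elt n
eval [] = one
eval (a ∷ w) = σ a · eval w

InW : ∀ {n} → Elt n → Set
InW {n} g = ∃ λ (w : Word n) → eval w ≡ g

Reduced : ∀ {n} → Elt n → Word n → Set
Reduced {n} g w = eval w ≡ g × (∀ (w' : Word n) → eval w' ≡ g → length w ≤ length w')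

data Far : ℕ → ℕ → Set where
  far₁ : ∀ {a b} → suc a < b → Far a b
  far₂ : ∀ {a b} → suc b < a → Far a b

data CommStep {n} : Word n → Word n → Set where
  swap : ∀ (xs ys : Word n) (a b : Fin n) → Far (toℕ a) (toℕ b) →
         CommStep (xs ++ (a ∷ b ∷ ys)) (xs ++ (b ∷ a ∷ ys))

FC : ∀ {n} → Elt n → Set
FC {n} g = InW g × (∀ (w w' : Word n) → Reduced g w → Reduced g w' → Star CommStep w w')

Ac : (n : ℕ) → Elt n → Set
Ac n g = FC g

-- [i,j] = σ_i σ_{i+1} ⋯ σ_j  (1-based indices i, j)
seg : ∀ {n} → ℕ → ℕ → Word n
seg {n} i j = filter (λ k → (i ≤? suc (toℕ k)) ×-dec (suc (toℕ k) ≤? j)) (allFin n)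

ValidPair : ℕ → ℕ × ℕ → Set
ValidPair n (i , j) = 1 ≤ i × i ≤ j × j ≤ n

Decr : List (ℕ × ℕ) → Set
Decr [] = ⊤
Decr (_ ∷ []) = ⊤
Decr ((i , j) ∷ (i' , j') ∷ r) = i' < i × j' < j × Decr ((i' , j') ∷ r)

Canonical : ℕ → List (ℕ × ℕ) → Set
Canonical n cs = All (ValidPair n) cs × Decr cs

canonWord : ∀ {n} → List (ℕ × ℕ) → Word n
canonWord [] = []
canonWord ((i , j) ∷ cs) = seg i j ++ canonWord cs

iA : (n : ℕ) → ℕ → Elt n → Set
iA n zero g = g ≡ one
iA n (suc i) g = FC g × Σ (ℕ × List (ℕ × ℕ)) λ { (j , cs) →
    Canonical n ((suc i , j) ∷ cs) × eval (canonWord {n} ((suc i , j) ∷ cs)) ≡ g }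

ι : ∀ {m} → Elt m → Elt (suc m)
ι {m} g = map inject₁ g ∷ʳ fromℕ (suc m)

-- A permutation's length is its number of inversions, and w is reduced iff its length is that
-- number. Fully commutative elements are the 321-avoiding permutations (Billey–Jockusch–Stanley):
-- for a 321-avoiding g, two reduced words ending in different letters end in far-apart letters,
-- so induction on the length links them by commutations; a 321-pattern can be shrunk by cancelling
-- descents until a braid σₑσₑ₊₁σₑ appears, giving reduced words with different numbers of σₑ.
-- A 321-avoiding g in W(A_{m+1}) either fixes m+1, so lies in W(A_m), or is [s+1, m+1] · h with
-- h 321-avoiding in W(A_m) and without inversions at values ≥ s; the latter forces the canonical
-- form of h to start below s+1. Both decompositions can be reversed.
module Submission where

open import Defs
open import Data.Nat using (ℕ; zero; suc; _+_; _∸_; _≤_; _<_; z≤n; s≤s; s≤s⁻¹; _≟_; _<?_; _≤?_)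
open import Data.Nat.Properties
open import Data.Nat.Tactic.RingSolver using (solve-∀)
open import Data.Fin as F using (Fin; toℕ; fromℕ<; inject₁; fromℕ)
open import Data.Fin.Properties using (toℕ-injective; toℕ<n; fromℕ<-toℕ; toℕ-fromℕ<; toℕ-inject₁; toℕ-fromℕ; any?)
open import Data.Fin.Permutation.Components using (transpose)
open import Data.Vec as V using (Vec; lookup; _∷ʳ_)
open import Data.Vec.Properties using (lookup∘tabulate; tabulate∘lookup; tabulate-cong; lookup-map)
open import Data.List as L using (List; []; _∷_; length; _++_; reverse; initLast; _∷ʳ′_)
open import Data.List.Properties
  using (length-++; unfold-reverse; reverse-involutive; length-reverse; ++-assoc; map-tabulate; upTo-∷ʳ;
         filter-++; filter-accept; filter-reject; ++-identityʳ)
open import Data.List.Relation.Unary.All as All using (All; []; _∷_)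
open import Data.Product using (_×_; _,_; ∃; proj₁; proj₂)
open import Data.Sum using (_⊎_; inj₁; inj₂)
open import Data.Unit using (tt)
open import Data.Empty using (⊥; ⊥-elim)
open import Data.Bool using (true; false; if_then_else_)
open import Function using (_∘_)
open import Function.Bundles using (_⇔_; mk⇔)
open import Relation.Nullary using (¬_; Dec; yes; no; does; _×-dec_)
open import Relation.Binary.Definitions using (Tri; tri<; tri≈; tri>)
open import Relation.Binary.PropositionalEquality
open import Relation.Binary.Construct.Closure.ReflexiveTransitive using (Star; ε; _◅_; _◅◅_; gmap)

opaque
  τ : ℕ → ℕ → ℕ
  τ a x with x ≟ a
  ... | yes _ = suc a
  ... | no _ with x ≟ suc a
  ...   | yes _ = a
  ...   | no _ = x

  τ-at : ∀ a → τ a a ≡ suc a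
  τ-at a with a ≟ a
  ... | yes _ = refl
  ... | no a≢a = ⊥-elim (a≢a refl)

  τ-at-suc : ∀ a → τ a (suc a) ≡ a
  τ-at-suc a with suc a ≟ a
  ... | yes e = ⊥-elim (1+n≢n e)
  ... | no _ with suc a ≟ suc a
  ...   | yes _ = refl
  ...   | no ne = ⊥-elim (ne refl)

  τ-away : ∀ a x → x ≢ a → x ≢ suc a → τ a x ≡ x
  τ-away a x x≢a x≢1+a with x ≟ a
  ... | yes e = ⊥-elim (x≢a e)
  ... | no _ with x ≟ suc a
  ...   | yes e = ⊥-elim (x≢1+a e)
  ...   | no _ = refl

data τ-Case (a x : ℕ) : Set where
  at     : x ≡ a → τ-Case a x
  at-suc : x ≡ suc a → τ-Case a x
  away   : x ≢ a → x ≢ suc a → τ-Case a x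

τ-case : ∀ a x → τ-Case a x
τ-case a x with x ≟ a
... | yes e = at e
... | no x≢a with x ≟ suc a
...   | yes e = at-suc e
...   | no x≢1+a = away x≢a x≢1+a

τ-involutive : ∀ a x → τ a (τ a x) ≡ x
τ-involutive a x with τ-case a x
... | at refl = trans (cong (τ a) (τ-at a)) (τ-at-suc a)
... | at-suc refl = trans (cong (τ a) (τ-at-suc a)) (τ-at a)
... | away p q = trans (cong (τ a) (τ-away a x p q)) (τ-away a x p q)

τ-injective : ∀ a {x y} → τ a x ≡ τ a y → x ≡ y
τ-injective a {x} {y} e = trans (sym (τ-involutive a x)) (trans (cong (τ a) e) (τ-involutive a y))

τ-suc-0 : ∀ a → τ (suc a) 0 ≡ 0
τ-suc-0 a = τ-away (suc a) 0 (λ ()) (λ ())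

τ-suc-suc : ∀ a x → τ (suc a) (suc x) ≡ suc (τ a x)
τ-suc-suc a x with τ-case a x
... | at refl = trans (τ-at (suc a)) (cong suc (sym (τ-at a)))
... | at-suc refl = trans (τ-at-suc (suc a)) (cong suc (sym (τ-at-suc a)))
... | away p q = trans (τ-away (suc a) (suc x) (p ∘ suc-injective) (q ∘ suc-injective)) (cong suc (sym (τ-away a x p q)))

τ-0-suc-suc : ∀ x → τ 0 (suc (suc x)) ≡ suc (suc x)
τ-0-suc-suc x = τ-away 0 (suc (suc x)) (λ ()) (λ e → 0≢1+n (sym (suc-injective e)))

τ-< : ∀ a {N} x → suc a < N → x < N → τ a x < N
τ-< a x a<N x<N with τ-case a x
... | at refl = subst (_< _) (sym (τ-at a)) a<N
... | at-suc refl = subst (_< _) (sym (τ-at-suc a)) (<-trans (n<1+n a) a<N)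
... | away p q = subst (_< _) (sym (τ-away a x p q)) x<N

τ-monotone : ∀ a {x y} → x < y → ¬ (x ≡ a × y ≡ suc a) → τ a x < τ a y
τ-monotone a {x} {y} lt not-ab with τ-case a x | τ-case a y
... | at refl | at refl = ⊥-elim (<-irrefl refl lt)
... | at refl | at-suc refl = ⊥-elim (not-ab (refl , refl))
... | at refl | away p q rewrite τ-at a | τ-away a y p q = ≤∧≢⇒< lt (q ∘ sym)
... | at-suc refl | at refl = ⊥-elim (<-asym lt (n<1+n a))
... | at-suc refl | at-suc refl = ⊥-elim (<-irrefl refl lt)
... | at-suc refl | away p q rewrite τ-at-suc a | τ-away a y p q = <-trans (n<1+n a) lt
... | away p q | at refl rewrite τ-at a | τ-away a x p q = <-trans lt (n<1+n a)
... | away p q | at-suc refl rewrite τ-at-suc a | τ-away a x p q = ≤∧≢⇒< (s≤s⁻¹ lt) p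
... | away p q | away p' q' rewrite τ-away a x p q | τ-away a y p' q' = lt

τ-suc-at : ∀ a → τ (suc a) a ≡ a
τ-suc-at a = τ-away (suc a) a (λ e → 1+n≢n (sym e)) (λ e → <-irrefl e (<-trans (n<1+n a) (n<1+n (suc a))))

τ-at-suc-suc : ∀ a → τ a (suc (suc a)) ≡ suc (suc a)
τ-at-suc-suc a = τ-away a _ (λ e → <-irrefl (sym e) (<-trans (n<1+n a) (n<1+n (suc a)))) (1+n≢n)

τ-braid : ∀ a x → τ a (τ (suc a) (τ a x)) ≡ τ (suc a) (τ a (τ (suc a) x))
τ-braid a x with τ-case a x | τ-case (suc a) x
... | at refl | _ rewrite τ-at a | τ-at (suc a) | τ-at-suc-suc a | τ-suc-at a | τ-at a | τ-at (suc a) = refl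
... | at-suc refl | _ rewrite τ-at-suc a | τ-suc-at a | τ-at a | τ-at (suc a) | τ-at-suc-suc a | τ-at-suc (suc a) = refl
... | away p q | at refl = ⊥-elim (q refl)
... | away p q | at-suc refl rewrite τ-at-suc-suc a | τ-at-suc (suc a) | τ-at-suc a | τ-suc-at a = refl
... | away p q | away p' q' rewrite τ-away a x p q | τ-away (suc a) x p' q' | τ-away a x p q | τ-away (suc a) x p' q' = refl

Far-sym : ∀ {a b} → Far a b → Far b a
Far-sym (far₁ x) = far₂ x
Far-sym (far₂ x) = far₁ x

Far⇒away : ∀ {a b} → Far a b → (b ≢ a × b ≢ suc a) × (suc b ≢ a × suc b ≢ suc a)
Far⇒away {a} {b} (far₁ lt) =
  ((λ e → close (≤-trans (≤-reflexive e) (n≤1+n a))) , (λ e → close (≤-reflexive e))) ,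
  ((λ e → close (≤-trans (n≤1+n b) (≤-trans (≤-reflexive e) (n≤1+n a)))) , (λ e → close (≤-trans (≤-reflexive (suc-injective e)) (n≤1+n a))))
  where
  close : b ≤ suc a → ⊥
  close b≤1+a = 1+n≰n (≤-trans lt b≤1+a)
Far⇒away (far₂ lt) with Far⇒away (far₁ lt)
... | (a≢b , a≢1+b) , (1+a≢b , 1+a≢1+b) =
  ((a≢b ∘ sym) , (1+a≢b ∘ sym)) , ((a≢1+b ∘ sym) , (1+a≢1+b ∘ sym))

τ-comm : ∀ {a b} → Far a b → ∀ x → τ a (τ b x) ≡ τ b (τ a x)
τ-comm {a} {b} f x with Far⇒away f | Far⇒away (Far-sym f) | τ-case a x
... | _ | (a≢b , a≢1+b) , (1+a≢b , 1+a≢1+b) | at refl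
  rewrite τ-away b a a≢b a≢1+b | τ-at a | τ-away b (suc a) 1+a≢b 1+a≢1+b = refl
... | _ | (a≢b , a≢1+b) , (1+a≢b , 1+a≢1+b) | at-suc refl
  rewrite τ-away b (suc a) 1+a≢b 1+a≢1+b | τ-at-suc a | τ-away b a a≢b a≢1+b = refl
... | (b≢a , b≢1+a) , (1+b≢a , 1+b≢1+a) | _ | away p q with τ-case b x
...   | at refl rewrite τ-at b | τ-away a (suc b) 1+b≢a 1+b≢1+a | τ-away a b b≢a b≢1+a | τ-at b = refl
...   | at-suc refl rewrite τ-at-suc b | τ-away a b b≢a b≢1+a | τ-away a (suc b) 1+b≢a 1+b≢1+a | τ-at-suc b = refl
...   | away p' q' rewrite τ-away b x p' q' | τ-away a x p q | τ-away b x p' q' = refl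

-- An element acts on all of ℕ, fixing every point beyond n; this turns identities between
-- elements into pointwise arithmetic on ℕ.
opaque
  ⟦_⟧ : ∀ {n} → Elt n → ℕ → ℕ
  ⟦_⟧ {n} g x with x <? suc n
  ... | yes p = toℕ (lookup g (fromℕ< p))
  ... | no _ = x

  ⟦⟧-lookup : ∀ {n} (g : Elt n) (y : Fin (suc n)) → ⟦ g ⟧ (toℕ y) ≡ toℕ (lookup g y)
  ⟦⟧-lookup {n} g y with toℕ y <? suc n
  ... | yes p = cong (λ z → toℕ (lookup g z)) (fromℕ<-toℕ y p)
  ... | no y≮ = ⊥-elim (y≮ (toℕ<n y))

  ⟦⟧-beyond : ∀ {n} (g : Elt n) {x} → suc n ≤ x → ⟦ g ⟧ x ≡ x
  ⟦⟧-beyond {n} g {x} n<x with x <? suc n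
  ... | yes x<n = ⊥-elim (<⇒≱ x<n n<x)
  ... | no _ = refl

⟦⟧-fromℕ< : ∀ {n} (g : Elt n) {x} (x<n : x < suc n) → ⟦ g ⟧ x ≡ toℕ (lookup g (fromℕ< x<n))
⟦⟧-fromℕ< g {x} x<n = trans (cong ⟦ g ⟧ (sym (toℕ-fromℕ< x<n))) (⟦⟧-lookup g (fromℕ< x<n))

⟦⟧-< : ∀ {n} (g : Elt n) {x} → x < suc n → ⟦ g ⟧ x < suc n
⟦⟧-< g x<n rewrite ⟦⟧-fromℕ< g x<n = toℕ<n _

Elt-ext : ∀ {n} {g h : Elt n} → (∀ x → x < suc n → ⟦ g ⟧ x ≡ ⟦ h ⟧ x) → g ≡ h
Elt-ext {n} {g} {h} e = trans (sym (tabulate∘lookup g)) (trans (tabulate-cong pointwise) (tabulate∘lookup h))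
  where
  pointwise : ∀ y → lookup g y ≡ lookup h y
  pointwise y = toℕ-injective (trans (sym (⟦⟧-lookup g y)) (trans (e (toℕ y) (toℕ<n y)) (⟦⟧-lookup h y)))

⟦⟧-· : ∀ {n} (g h : Elt n) x → ⟦ g · h ⟧ x ≡ ⟦ g ⟧ (⟦ h ⟧ x)
⟦⟧-· {n} g h x with x <? suc n
... | no x≮ = trans (⟦⟧-beyond (g · h) (≮⇒≥ x≮)) (sym (trans (cong ⟦ g ⟧ (⟦⟧-beyond h (≮⇒≥ x≮))) (⟦⟧-beyond g (≮⇒≥ x≮))))
... | yes x<n = begin
    ⟦ g · h ⟧ x                                             ≡⟨ ⟦⟧-fromℕ< (g · h) x<n ⟩
    toℕ (lookup (g · h) y)                                  ≡⟨ cong toℕ (lookup∘tabulate (λ z → lookup g (lookup h z)) y) ⟩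
    toℕ (lookup g (lookup h y))                             ≡⟨ sym (⟦⟧-lookup g _) ⟩
    ⟦ g ⟧ (toℕ (lookup h y))                                ≡⟨ cong ⟦ g ⟧ (sym (⟦⟧-fromℕ< h x<n)) ⟩
    ⟦ g ⟧ (⟦ h ⟧ x)                                         ∎
  where
  open ≡-Reasoning
  y : Fin (suc n)
  y = fromℕ< x<n

⟦⟧-one : ∀ {n} x → ⟦ one {n} ⟧ x ≡ x
⟦⟧-one {n} x with x <? suc n
... | no x≮ = ⟦⟧-beyond one (≮⇒≥ x≮)
... | yes x<n = trans (⟦⟧-fromℕ< one x<n) (trans (cong toℕ (lookup∘tabulate (λ z → z) (fromℕ< x<n))) (toℕ-fromℕ< x<n))

⟦⟧-σ : ∀ {n} (k : Fin n) x → ⟦ σ k ⟧ x ≡ τ (toℕ k) x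
⟦⟧-σ {n} k x with x <? suc n
... | no x≮ = trans (⟦⟧-beyond (σ k) (≮⇒≥ x≮)) (sym (τ-away (toℕ k) x
      (λ e → x≮ (subst (_< suc n) (sym e) (m<n⇒m<1+n (toℕ<n k))))
      (λ e → x≮ (subst (_< suc n) (sym e) (s≤s (toℕ<n k))))))
... | yes x<n = trans (cong ⟦ σ k ⟧ (sym (toℕ-fromℕ< x<n))) (trans (on-Fin (fromℕ< x<n)) (cong (τ (toℕ k)) (toℕ-fromℕ< x<n)))
  where
  on-Fin : ∀ y → ⟦ σ k ⟧ (toℕ y) ≡ τ (toℕ k) (toℕ y)
  on-Fin y rewrite ⟦⟧-lookup (σ k) y | lookup∘tabulate (transpose (inject₁ k) (F.suc k)) y with y F.≟ inject₁ k
  ... | yes refl rewrite toℕ-inject₁ k = sym (τ-at (toℕ k))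
  ... | no y≢k with y F.≟ F.suc k
  ...   | yes refl = trans (toℕ-inject₁ k) (sym (τ-at-suc (toℕ k)))
  ...   | no y≢1+k = sym (τ-away (toℕ k) (toℕ y) (λ e → y≢k (toℕ-injective (trans e (sym (toℕ-inject₁ k))))) (y≢1+k ∘ toℕ-injective))

lookup-∷ʳ-inject₁ : ∀ {A : Set} {k} (xs : Vec A k) (z : A) (i : Fin k) → lookup (xs ∷ʳ z) (inject₁ i) ≡ lookup xs i
lookup-∷ʳ-inject₁ (x V.∷ xs) z F.zero = refl
lookup-∷ʳ-inject₁ (x V.∷ xs) z (F.suc i) = lookup-∷ʳ-inject₁ xs z i

lookup-∷ʳ-fromℕ : ∀ {A : Set} {k} (xs : Vec A k) (z : A) → lookup (xs ∷ʳ z) (fromℕ k) ≡ z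
lookup-∷ʳ-fromℕ V.[] z = refl
lookup-∷ʳ-fromℕ (x V.∷ xs) z = lookup-∷ʳ-fromℕ xs z

⟦⟧-ι : ∀ {m} (h : Elt m) x → ⟦ ι h ⟧ x ≡ ⟦ h ⟧ x
⟦⟧-ι {m} h x with <-cmp x (suc m)
... | tri< x<m _ _ = begin
    ⟦ ι h ⟧ x                                                   ≡⟨ cong ⟦ ι h ⟧ (sym (trans (toℕ-inject₁ y) (toℕ-fromℕ< x<m))) ⟩
    ⟦ ι h ⟧ (toℕ (inject₁ y))                                   ≡⟨ ⟦⟧-lookup (ι h) (inject₁ y) ⟩
    toℕ (lookup (V.map inject₁ h ∷ʳ fromℕ (suc m)) (inject₁ y)) ≡⟨ cong toℕ (lookup-∷ʳ-inject₁ (V.map inject₁ h) _ y) ⟩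
    toℕ (lookup (V.map inject₁ h) y)                            ≡⟨ cong toℕ (lookup-map y inject₁ h) ⟩
    toℕ (inject₁ (lookup h y))                                  ≡⟨ toℕ-inject₁ _ ⟩
    toℕ (lookup h y)                                            ≡⟨ sym (⟦⟧-fromℕ< h x<m) ⟩
    ⟦ h ⟧ x                                                     ∎
  where
  open ≡-Reasoning
  y : Fin (suc m)
  y = fromℕ< x<m
... | tri≈ _ refl _ = begin
    ⟦ ι h ⟧ (suc m)                                                      ≡⟨ cong ⟦ ι h ⟧ (sym (toℕ-fromℕ (suc m))) ⟩
    ⟦ ι h ⟧ (toℕ (fromℕ (suc m)))                                        ≡⟨ ⟦⟧-lookup (ι h) (fromℕ (suc m)) ⟩
    toℕ (lookup (V.map inject₁ h ∷ʳ fromℕ (suc m)) (fromℕ (suc m)))      ≡⟨ cong toℕ (lookup-∷ʳ-fromℕ (V.map inject₁ h) _) ⟩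
    toℕ (fromℕ (suc m))                                                  ≡⟨ toℕ-fromℕ (suc m) ⟩
    suc m                                                                ≡⟨ sym (⟦⟧-beyond h ≤-refl) ⟩
    ⟦ h ⟧ (suc m)                                                        ∎
  where open ≡-Reasoning
... | tri> _ _ m<x = trans (⟦⟧-beyond (ι h) m<x) (sym (⟦⟧-beyond h (<⇒≤ m<x)))

⟦_⟧ʷ : ∀ {n} → Word n → ℕ → ℕ
⟦ [] ⟧ʷ x = x
⟦ a ∷ w ⟧ʷ x = τ (toℕ a) (⟦ w ⟧ʷ x)

⟦⟧-eval : ∀ {n} (w : Word n) x → ⟦ eval w ⟧ x ≡ ⟦ w ⟧ʷ x
⟦⟧-eval [] x = ⟦⟧-one x
⟦⟧-eval (a ∷ w) x = trans (⟦⟧-· (σ a) (eval w) x) (trans (⟦⟧-σ a _) (cong (τ (toℕ a)) (⟦⟧-eval w x)))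

⟦⟧ʷ-++ : ∀ {n} (u v : Word n) x → ⟦ u ++ v ⟧ʷ x ≡ ⟦ u ⟧ʷ (⟦ v ⟧ʷ x)
⟦⟧ʷ-++ [] v x = refl
⟦⟧ʷ-++ (a ∷ u) v x = cong (τ (toℕ a)) (⟦⟧ʷ-++ u v x)

⟦⟧ʷ-injective : ∀ {n} (w : Word n) {x y} → ⟦ w ⟧ʷ x ≡ ⟦ w ⟧ʷ y → x ≡ y
⟦⟧ʷ-injective [] e = e
⟦⟧ʷ-injective (a ∷ w) e = ⟦⟧ʷ-injective w (τ-injective (toℕ a) e)

⟦⟧ʷ-reverse-inverseˡ : ∀ {n} (w : Word n) x → ⟦ reverse w ⟧ʷ (⟦ w ⟧ʷ x) ≡ x
⟦⟧ʷ-reverse-inverseˡ [] x = refl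
⟦⟧ʷ-reverse-inverseˡ (a ∷ w) x = begin
  ⟦ reverse (a ∷ w) ⟧ʷ (τ (toℕ a) (⟦ w ⟧ʷ x))   ≡⟨ cong (λ z → ⟦ z ⟧ʷ (τ (toℕ a) (⟦ w ⟧ʷ x))) (unfold-reverse a w) ⟩
  ⟦ reverse w ++ a ∷ [] ⟧ʷ (τ (toℕ a) (⟦ w ⟧ʷ x)) ≡⟨ ⟦⟧ʷ-++ (reverse w) (a ∷ []) _ ⟩
  ⟦ reverse w ⟧ʷ (τ (toℕ a) (τ (toℕ a) (⟦ w ⟧ʷ x))) ≡⟨ cong ⟦ reverse w ⟧ʷ (τ-involutive (toℕ a) _) ⟩
  ⟦ reverse w ⟧ʷ (⟦ w ⟧ʷ x)                     ≡⟨ ⟦⟧ʷ-reverse-inverseˡ w x ⟩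
  x                                              ∎
  where open ≡-Reasoning

⟦⟧ʷ-reverse-inverseʳ : ∀ {n} (w : Word n) x → ⟦ w ⟧ʷ (⟦ reverse w ⟧ʷ x) ≡ x
⟦⟧ʷ-reverse-inverseʳ w x =
  trans (cong (λ z → ⟦ z ⟧ʷ (⟦ reverse w ⟧ʷ x)) (sym (reverse-involutive w))) (⟦⟧ʷ-reverse-inverseˡ (reverse w) x)

eval-++ : ∀ {n} (u v : Word n) → eval (u ++ v) ≡ eval u · eval v
eval-++ u v = Elt-ext λ x _ → begin
  ⟦ eval (u ++ v) ⟧ x         ≡⟨ ⟦⟧-eval (u ++ v) x ⟩
  ⟦ u ++ v ⟧ʷ x               ≡⟨ ⟦⟧ʷ-++ u v x ⟩
  ⟦ u ⟧ʷ (⟦ v ⟧ʷ x)           ≡⟨ sym (trans (cong ⟦ eval u ⟧ (⟦⟧-eval v x)) (⟦⟧-eval u _)) ⟩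
  ⟦ eval u ⟧ (⟦ eval v ⟧ x)   ≡⟨ sym (⟦⟧-· (eval u) (eval v) x) ⟩
  ⟦ eval u · eval v ⟧ x       ∎
  where open ≡-Reasoning

opaque
  χ< : ℕ → ℕ → ℕ
  χ< x v with x <? v
  ... | yes _ = 1
  ... | no _ = 0

  χ<-yes : ∀ {x v} → x < v → χ< x v ≡ 1
  χ<-yes {x} {v} x<v with x <? v
  ... | yes _ = refl
  ... | no x≮v = ⊥-elim (x≮v x<v)

  χ<-no : ∀ {x v} → ¬ x < v → χ< x v ≡ 0
  χ<-no {x} {v} x≮v with x <? v
  ... | yes x<v = ⊥-elim (x≮v x<v)
  ... | no _ = refl

countBelow : ℕ → ℕ → (ℕ → ℕ) → ℕ
countBelow v zero h = 0
countBelow v (suc N) h = χ< (h 0) v + countBelow v N (h ∘ suc)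

inversions : ℕ → (ℕ → ℕ) → ℕ
inversions zero f = 0
inversions (suc N) f = countBelow (f 0) N (f ∘ suc) + inversions N (f ∘ suc)

countBelow-cong : ∀ v N {h h'} → (∀ x → x < N → h x ≡ h' x) → countBelow v N h ≡ countBelow v N h'
countBelow-cong v zero e = refl
countBelow-cong v (suc N) e =
  cong₂ _+_ (cong (λ z → χ< z v) (e 0 (s≤s z≤n))) (countBelow-cong v N (λ x p → e (suc x) (s≤s p)))

inversions-cong : ∀ N {f f'} → (∀ x → x < N → f x ≡ f' x) → inversions N f ≡ inversions N f'
inversions-cong zero e = refl
inversions-cong (suc N) {f} {f'} e =
  cong₂ _+_ (trans (cong (λ z → countBelow z N (f ∘ suc)) (e 0 (s≤s z≤n))) (countBelow-cong _ N (λ x p → e (suc x) (s≤s p))))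
            (inversions-cong N (λ x p → e (suc x) (s≤s p)))

countBelow-∘τ : ∀ v a N h → suc a < N → countBelow v N (h ∘ τ a) ≡ countBelow v N h
countBelow-∘τ v zero (suc (suc N)) h _ = begin
  χ< (h (τ 0 0)) v + (χ< (h (τ 0 1)) v + countBelow v N (h ∘ τ 0 ∘ suc ∘ suc))
    ≡⟨ cong₂ (λ a b → χ< (h a) v + (χ< (h b) v + countBelow v N (h ∘ τ 0 ∘ suc ∘ suc))) (τ-at 0) (τ-at-suc 0) ⟩
  χ< (h 1) v + (χ< (h 0) v + countBelow v N (h ∘ τ 0 ∘ suc ∘ suc))
    ≡⟨ cong (λ z → χ< (h 1) v + (χ< (h 0) v + z)) (countBelow-cong v N (λ x _ → cong h (τ-0-suc-suc x))) ⟩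
  χ< (h 1) v + (χ< (h 0) v + countBelow v N (h ∘ suc ∘ suc))
    ≡⟨ swap-front (χ< (h 1) v) (χ< (h 0) v) _ ⟩
  χ< (h 0) v + (χ< (h 1) v + countBelow v N (h ∘ suc ∘ suc)) ∎
  where
  open ≡-Reasoning
  swap-front : ∀ a b c → a + (b + c) ≡ b + (a + c)
  swap-front = solve-∀
countBelow-∘τ v zero (suc zero) h (s≤s ())
countBelow-∘τ v (suc a) (suc N) h (s≤s a<N) =
  cong₂ _+_ (cong (λ z → χ< (h z) v) (τ-suc-0 a))
    (trans (countBelow-cong v N (λ x _ → cong h (τ-suc-suc a x))) (countBelow-∘τ v a N (h ∘ suc) a<N))

inversions-∘τ : ∀ a N f → suc a < N →
  inversions N (f ∘ τ a) + χ< (f (suc a)) (f a) ≡ inversions N f + χ< (f a) (f (suc a))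
inversions-∘τ zero (suc (suc N)) f _ = begin
  countBelow (f (τ 0 0)) (suc N) g + inversions (suc N) g + χ< (f 1) (f 0)
    ≡⟨ cong (_+ χ< (f 1) (f 0)) (cong₂ _+_ first rest) ⟩
  (χ< (f 0) (f 1) + countBelow (f 1) N f₂) + (countBelow (f 0) N f₂ + inversions N f₂) + χ< (f 1) (f 0)
    ≡⟨ rearrange (χ< (f 0) (f 1)) (χ< (f 1) (f 0)) _ _ _ ⟩
  χ< (f 1) (f 0) + countBelow (f 0) N f₂ + (countBelow (f 1) N f₂ + inversions N f₂) + χ< (f 0) (f 1) ∎
  where
  open ≡-Reasoning
  g f₂ : ℕ → ℕ
  g = f ∘ τ 0 ∘ suc
  f₂ = f ∘ suc ∘ suc
  rearrange : ∀ a b c d e → a + c + (d + e) + b ≡ b + d + (c + e) + a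
  rearrange = solve-∀
  first : countBelow (f (τ 0 0)) (suc N) g ≡ χ< (f 0) (f 1) + countBelow (f 1) N f₂
  first = trans (cong (λ z → countBelow (f z) (suc N) g) (τ-at 0))
            (cong₂ _+_ (cong (λ z → χ< (f z) (f 1)) (τ-at-suc 0)) (countBelow-cong (f 1) N (λ x _ → cong f (τ-0-suc-suc x))))
  rest : inversions (suc N) g ≡ countBelow (f 0) N f₂ + inversions N f₂
  rest = cong₂ _+_ (trans (cong (λ z → countBelow (f z) N (g ∘ suc)) (τ-at-suc 0)) (countBelow-cong (f 0) N (λ x _ → cong f (τ-0-suc-suc x))))
                   (inversions-cong N (λ x _ → cong f (τ-0-suc-suc x)))
inversions-∘τ zero (suc zero) f (s≤s ())
inversions-∘τ (suc a) (suc N) f (s≤s a<N) = begin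
  countBelow (f (τ (suc a) 0)) N (f ∘ τ (suc a) ∘ suc) + inversions N (f ∘ τ (suc a) ∘ suc) + χ< (f (suc (suc a))) (f (suc a))
    ≡⟨ cong (λ z → z + inversions N (f ∘ τ (suc a) ∘ suc) + χ< (f (suc (suc a))) (f (suc a))) first ⟩
  c + inversions N (f ∘ τ (suc a) ∘ suc) + χ< (f (suc (suc a))) (f (suc a))
    ≡⟨ +-assoc c _ _ ⟩
  c + (inversions N (f ∘ τ (suc a) ∘ suc) + χ< (f (suc (suc a))) (f (suc a)))
    ≡⟨ cong (λ z → c + (z + χ< (f (suc (suc a))) (f (suc a)))) (inversions-cong N (λ x _ → cong f (τ-suc-suc a x))) ⟩
  c + (inversions N (f ∘ suc ∘ τ a) + χ< (f (suc (suc a))) (f (suc a)))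
    ≡⟨ cong (c +_) (inversions-∘τ a N (f ∘ suc) a<N) ⟩
  c + (inversions N (f ∘ suc) + χ< (f (suc a)) (f (suc (suc a))))
    ≡⟨ sym (+-assoc c _ _) ⟩
  inversions (suc N) f + χ< (f (suc a)) (f (suc (suc a))) ∎
  where
  open ≡-Reasoning
  c : ℕ
  c = countBelow (f 0) N (f ∘ suc)
  first : countBelow (f (τ (suc a) 0)) N (f ∘ τ (suc a) ∘ suc) ≡ c
  first = trans (cong (λ z → countBelow (f z) N (f ∘ τ (suc a) ∘ suc)) (τ-suc-0 a))
            (trans (countBelow-cong (f 0) N (λ x _ → cong f (τ-suc-suc a x))) (countBelow-∘τ (f 0) a N (f ∘ suc) a<N))

inversions-∘τ-desc : ∀ a N f → suc a < N → f (suc a) < f a → suc (inversions N (f ∘ τ a)) ≡ inversions N f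
inversions-∘τ-desc a N f a<N d = begin
  suc (inversions N (f ∘ τ a))                       ≡⟨ +-comm 1 _ ⟩
  inversions N (f ∘ τ a) + 1                         ≡⟨ cong (inversions N (f ∘ τ a) +_) (sym (χ<-yes d)) ⟩
  inversions N (f ∘ τ a) + χ< (f (suc a)) (f a)      ≡⟨ inversions-∘τ a N f a<N ⟩
  inversions N f + χ< (f a) (f (suc a))              ≡⟨ cong (inversions N f +_) (χ<-no (<⇒≯ d)) ⟩
  inversions N f + 0                                 ≡⟨ +-identityʳ _ ⟩
  inversions N f                                     ∎
  where open ≡-Reasoning

inversions-∘τ-asc : ∀ a N f → suc a < N → f a < f (suc a) → inversions N (f ∘ τ a) ≡ suc (inversions N f)
inversions-∘τ-asc a N f a<N d = begin
  inversions N (f ∘ τ a)                             ≡⟨ sym (+-identityʳ _) ⟩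
  inversions N (f ∘ τ a) + 0                         ≡⟨ cong (inversions N (f ∘ τ a) +_) (sym (χ<-no (<⇒≯ d))) ⟩
  inversions N (f ∘ τ a) + χ< (f (suc a)) (f a)      ≡⟨ inversions-∘τ a N f a<N ⟩
  inversions N f + χ< (f a) (f (suc a))              ≡⟨ cong (inversions N f +_) (χ<-yes d) ⟩
  inversions N f + 1                                 ≡⟨ +-comm _ 1 ⟩
  suc (inversions N f)                               ∎
  where open ≡-Reasoning

inversions-∘τ-≤ : ∀ a N f → suc a < N → inversions N (f ∘ τ a) ≤ suc (inversions N f)
inversions-∘τ-≤ a N f a<N with <-cmp (f a) (f (suc a))
... | tri< lt _ _ = ≤-reflexive (inversions-∘τ-asc a N f a<N lt)
... | tri> _ _ gt = ≤-trans (n≤1+n _) (≤-trans (≤-reflexive (inversions-∘τ-desc a N f a<N gt)) (n≤1+n _))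
... | tri≈ _ e _ = ≤-trans (≤-reflexive same) (n≤1+n _)
  where
  same : inversions N (f ∘ τ a) ≡ inversions N f
  same = +-cancelʳ-≡ 0 _ _ (trans (cong (inversions N (f ∘ τ a) +_) (sym (χ<-no (<-irrefl (sym e)))))
           (trans (inversions-∘τ a N f a<N) (cong (inversions N f +_) (χ<-no (<-irrefl e)))))

Increasing : ℕ → (ℕ → ℕ) → Set
Increasing N f = ∀ x → suc x < N → f x < f (suc x)

countBelow-none : ∀ v N h → (∀ x → x < N → ¬ h x < v) → countBelow v N h ≡ 0
countBelow-none v zero h _ = refl
countBelow-none v (suc N) h none =
  cong₂ _+_ (χ<-no (none 0 (s≤s z≤n))) (countBelow-none v N (h ∘ suc) (λ x lt → none (suc x) (s≤s lt)))

Increasing-monotone : ∀ N f → Increasing N f → ∀ x y → x < y → y < N → f x < f y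
Increasing-monotone N f inc x (suc y) (s≤s x≤y) 1+y<N with m≤n⇒m<n∨m≡n x≤y
... | inj₁ x<y = <-trans (Increasing-monotone N f inc x y x<y (<-trans (n<1+n y) 1+y<N)) (inc y 1+y<N)
... | inj₂ refl = inc x 1+y<N

inversions-Increasing : ∀ N f → Increasing N f → inversions N f ≡ 0
inversions-Increasing zero f _ = refl
inversions-Increasing (suc N) f inc =
  cong₂ _+_ (countBelow-none (f 0) N (f ∘ suc) (λ x lt → <⇒≯ (Increasing-monotone (suc N) f inc 0 (suc x) (s≤s z≤n) (s≤s lt))))
            (inversions-Increasing N (f ∘ suc) (λ x lt → inc (suc x) (s≤s lt)))

Increasing-≥ : ∀ N f → Increasing N f → ∀ x → x < N → x ≤ f x
Increasing-≥ N f inc zero _ = z≤n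
Increasing-≥ N f inc (suc x) 1+x<N = ≤-trans (s≤s (Increasing-≥ N f inc x (<-trans (n<1+n x) 1+x<N))) (inc x 1+x<N)

Increasing-gap : ∀ N f → Increasing N f → (∀ x → x < N → f x < N) → ∀ d x → x + d < N → f x + d < N
Increasing-gap N f inc f<N zero x lt = subst (_< N) (sym (+-identityʳ _)) (f<N x (subst (_< N) (+-identityʳ x) lt))
Increasing-gap N f inc f<N (suc d) x lt = begin-strict
  f x + suc d       ≡⟨ +-suc (f x) d ⟩
  suc (f x) + d     ≤⟨ +-monoˡ-≤ d (inc x (≤-trans (s≤s (m≤m+n (suc x) d)) lt')) ⟩
  f (suc x) + d     <⟨ Increasing-gap N f inc f<N d (suc x) lt' ⟩
  N                 ∎
  where
  open ≤-Reasoning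
  lt' : suc x + d < N
  lt' = ≤-trans (≤-reflexive (cong suc (sym (+-suc x d)))) lt

Increasing⇒id : ∀ N f → Increasing N f → (∀ x → x < N → f x < N) → ∀ x → x < N → f x ≡ x
Increasing⇒id N f inc f<N x x<N = ≤-antisym ≤x (Increasing-≥ N f inc x x<N)
  where
  d : ℕ
  d = N ∸ suc x
  ≤x : f x ≤ x
  ≤x = +-cancelʳ-≤ d (f x) x (s≤s⁻¹ (≤-trans (Increasing-gap N f inc f<N d x (≤-reflexive (m+[n∸m]≡n x<N)))
                                                  (≤-reflexive (sym (m+[n∸m]≡n x<N)))))

·-identityʳ : ∀ {n} (g : Elt n) → g · one ≡ g
·-identityʳ g = Elt-ext λ x _ → trans (⟦⟧-· g one x) (cong ⟦ g ⟧ (⟦⟧-one x))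

⟦⟧-·σ : ∀ {n} (g : Elt n) (a : Fin n) x → ⟦ g · σ a ⟧ x ≡ ⟦ g ⟧ (τ (toℕ a) x)
⟦⟧-·σ g a x = trans (⟦⟧-· g (σ a) x) (cong ⟦ g ⟧ (⟦⟧-σ a x))

·σ-·σ : ∀ {n} (g : Elt n) (a : Fin n) → (g · σ a) · σ a ≡ g
·σ-·σ g a = Elt-ext λ x _ → trans (⟦⟧-·σ (g · σ a) a x) (trans (⟦⟧-·σ g a _) (cong ⟦ g ⟧ (τ-involutive (toℕ a) x)))

eval-∷ʳ : ∀ {n} (w : Word n) (a : Fin n) → eval (w ++ a ∷ []) ≡ eval w · σ a
eval-∷ʳ w a = trans (eval-++ w (a ∷ [])) (cong (eval w ·_) (·-identityʳ (σ a)))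

IsInjective : ∀ {n} → Elt n → Set
IsInjective g = ∀ {x y} → ⟦ g ⟧ x ≡ ⟦ g ⟧ y → x ≡ y

eval-injective : ∀ {n} (w : Word n) → IsInjective (eval w)
eval-injective w {x} {y} e = ⟦⟧ʷ-injective w (trans (sym (⟦⟧-eval w x)) (trans e (⟦⟧-eval w y)))

InW⇒injective : ∀ {n} {g : Elt n} → InW g → IsInjective g
InW⇒injective (w , refl) = eval-injective w

·σ-injective : ∀ {n} (g : Elt n) (a : Fin n) → IsInjective g → IsInjective (g · σ a)
·σ-injective g a inj {x} {y} e = τ-injective (toℕ a) (inj (trans (sym (⟦⟧-·σ g a x)) (trans e (⟦⟧-·σ g a y))))

ℓ : ∀ {n} → Elt n → ℕ
ℓ {n} g = inversions (suc n) ⟦ g ⟧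

Descent : ∀ {n} → Elt n → Fin n → Set
Descent g a = ⟦ g ⟧ (suc (toℕ a)) < ⟦ g ⟧ (toℕ a)

ℓ-·σ-descent : ∀ {n} (g : Elt n) (a : Fin n) → Descent g a → suc (ℓ (g · σ a)) ≡ ℓ g
ℓ-·σ-descent {n} g a d =
  trans (cong suc (inversions-cong (suc n) (λ x _ → ⟦⟧-·σ g a x))) (inversions-∘τ-desc (toℕ a) (suc n) ⟦ g ⟧ (s≤s (toℕ<n a)) d)

ℓ-·σ-ascent : ∀ {n} (g : Elt n) (a : Fin n) → ⟦ g ⟧ (toℕ a) < ⟦ g ⟧ (suc (toℕ a)) → ℓ (g · σ a) ≡ suc (ℓ g)
ℓ-·σ-ascent {n} g a d =
  trans (inversions-cong (suc n) (λ x _ → ⟦⟧-·σ g a x)) (inversions-∘τ-asc (toℕ a) (suc n) ⟦ g ⟧ (s≤s (toℕ<n a)) d)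

-- ⟦ reverse w ⟧ʷ is ⟦ eval w ⟧ read from the right, so each letter precomposes with a τ.
ℓ-eval≤length : ∀ {n} (w : Word n) → ℓ (eval w) ≤ length w
ℓ-eval≤length {n} w = begin
  ℓ (eval w)                                       ≡⟨ inversions-cong (suc n) (λ x _ →
                                                        trans (⟦⟧-eval w x) (cong (λ z → ⟦ z ⟧ʷ x) (sym (reverse-involutive w)))) ⟩
  inversions (suc n) ⟦ reverse (reverse w) ⟧ʷ      ≤⟨ reversed (reverse w) ⟩
  length (reverse w)                               ≡⟨ length-reverse w ⟩
  length w                                         ∎
  where
  open ≤-Reasoning
  reversed : (u : Word n) → inversions (suc n) ⟦ reverse u ⟧ʷ ≤ length u
  reversed [] = ≤-reflexive (inversions-Increasing (suc n) (λ x → x) (λ _ _ → n<1+n _))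
  reversed (a ∷ u) = begin
    inversions (suc n) ⟦ reverse (a ∷ u) ⟧ʷ            ≡⟨ inversions-cong (suc n) (λ x _ →
                                                            trans (cong (λ z → ⟦ z ⟧ʷ x) (unfold-reverse a u)) (⟦⟧ʷ-++ (reverse u) (a ∷ []) x)) ⟩
    inversions (suc n) (⟦ reverse u ⟧ʷ ∘ τ (toℕ a))    ≤⟨ inversions-∘τ-≤ (toℕ a) (suc n) ⟦ reverse u ⟧ʷ (s≤s (toℕ<n a)) ⟩
    suc (inversions (suc n) ⟦ reverse u ⟧ʷ)            ≤⟨ s≤s (reversed u) ⟩
    length (a ∷ u)                                     ∎

noDescent⇒Increasing : ∀ {n} (g : Elt n) → IsInjective g → ¬ (∃ λ a → Descent g a) → Increasing (suc n) ⟦ g ⟧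
noDescent⇒Increasing {n} g inj none x 1+x<1+n with <-cmp (⟦ g ⟧ x) (⟦ g ⟧ (suc x))
... | tri< lt _ _ = lt
... | tri≈ _ e _ = ⊥-elim (1+n≢n (sym (inj e)))
... | tri> _ _ gt = ⊥-elim (none (a , subst (λ z → ⟦ g ⟧ (suc z) < ⟦ g ⟧ z) (sym (toℕ-fromℕ< x<n)) gt))
  where
  x<n : x < n
  x<n = s≤s⁻¹ 1+x<1+n
  a : Fin n
  a = fromℕ< x<n

-- Bubble sort: peel off a right descent until none is left; then ⟦ g ⟧ is increasing, hence the identity.
word-of-length-ℓ : ∀ {n} (g : Elt n) → IsInjective g → ∃ λ w → eval w ≡ g × length w ≡ ℓ g
word-of-length-ℓ {n} g inj = go (ℓ g) g inj refl
  where
  go : ∀ k (g : Elt n) → IsInjective g → ℓ g ≡ k → ∃ λ w → eval w ≡ g × length w ≡ k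
  go k g inj ℓg≡k with any? {n = n} (λ a → ⟦ g ⟧ (suc (toℕ a)) <? ⟦ g ⟧ (toℕ a))
  go zero g inj ℓg≡0 | yes (a , d) = ⊥-elim (0≢1+n (trans (sym ℓg≡0) (sym (ℓ-·σ-descent g a d))))
  go (suc k) g inj ℓg≡1+k | yes (a , d) with go k (g · σ a) (·σ-injective g a inj) (suc-injective (trans (ℓ-·σ-descent g a d) ℓg≡1+k))
  ... | w , ew , lw = w ++ a ∷ [] , ev , trans (length-++ w) (trans (+-comm (length w) 1) (cong suc lw))
    where
    ev : eval (w ++ a ∷ []) ≡ g
    ev = trans (eval-∷ʳ w a) (trans (cong (_· σ a) ew) (·σ-·σ g a))
  go zero g inj _ | no none = [] , Elt-ext (λ x x<n → trans (⟦⟧-one x)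
    (sym (Increasing⇒id (suc n) ⟦ g ⟧ (noDescent⇒Increasing g inj none) (λ _ → ⟦⟧-< g) x x<n))) , refl
  go (suc k) g inj ℓg≡1+k | no none =
    ⊥-elim (0≢1+n (trans (sym (inversions-Increasing (suc n) ⟦ g ⟧ (noDescent⇒Increasing g inj none))) ℓg≡1+k))

reduced⇒length≡ℓ : ∀ {n} {g : Elt n} w → Reduced g w → length w ≡ ℓ g
reduced⇒length≡ℓ {g = g} w (refl , minimal) with word-of-length-ℓ g (eval-injective w)
... | w' , ew' , lw' = ≤-antisym (≤-trans (minimal w' ew') (≤-reflexive lw')) (ℓ-eval≤length w)

length≡ℓ⇒reduced : ∀ {n} {g : Elt n} w → eval w ≡ g → length w ≡ ℓ g → Reduced g w
length≡ℓ⇒reduced w ew lw = ew , λ w' ew' → ≤-trans (≤-reflexive lw) (subst (λ z → ℓ z ≤ length w') ew' (ℓ-eval≤length w'))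

reduced-exists : ∀ {n} (g : Elt n) → IsInjective g → ∃ λ w → Reduced g w
reduced-exists g inj with word-of-length-ℓ g inj
... | w , ew , lw = w , length≡ℓ⇒reduced w ew lw

Reduced-∷ʳ⁻ : ∀ {n} {g : Elt n} u a → Reduced g (u ++ a ∷ []) → Descent g a × Reduced (g · σ a) u
Reduced-∷ʳ⁻ {n} {g} u a red with <-cmp (⟦ g ⟧ (toℕ a)) (⟦ g ⟧ (suc (toℕ a)))
... | tri≈ _ e _ = ⊥-elim (1+n≢n (sym (InW⇒injective (u ++ a ∷ [] , proj₁ red) e)))
... | tri< asc _ _ = ⊥-elim (1+n≰n (≤-trans (n≤1+n _) (subst (_≤ length u) ℓ≡ (ℓ-eval≤length u))))
  where
  ℓ≡ : ℓ (eval u) ≡ suc (suc (length u))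
  ℓ≡ = begin
    ℓ (eval u)                 ≡⟨ cong ℓ (trans (sym (·σ-·σ (eval u) a)) (cong (_· σ a) (trans (sym (eval-∷ʳ u a)) (proj₁ red)))) ⟩
    ℓ (g · σ a)                ≡⟨ ℓ-·σ-ascent g a asc ⟩
    suc (ℓ g)                  ≡⟨ cong suc (sym (reduced⇒length≡ℓ (u ++ a ∷ []) red)) ⟩
    suc (length (u ++ a ∷ [])) ≡⟨ cong suc (trans (length-++ u) (+-comm (length u) 1)) ⟩
    suc (suc (length u))       ∎
    where open ≡-Reasoning
... | tri> _ _ d = d , length≡ℓ⇒reduced u eu (suc-injective (begin
    suc (length u)             ≡⟨ trans (+-comm 1 (length u)) (sym (length-++ u)) ⟩
    length (u ++ a ∷ [])       ≡⟨ reduced⇒length≡ℓ (u ++ a ∷ []) red ⟩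
    ℓ g                        ≡⟨ sym (ℓ-·σ-descent g a d) ⟩
    suc (ℓ (g · σ a))          ∎))
  where
  open ≡-Reasoning
  eu : eval u ≡ g · σ a
  eu = trans (sym (·σ-·σ (eval u) a)) (cong (_· σ a) (trans (sym (eval-∷ʳ u a)) (proj₁ red)))

Reduced-∷ʳ : ∀ {n} {g : Elt n} u a → Descent g a → Reduced (g · σ a) u → Reduced g (u ++ a ∷ [])
Reduced-∷ʳ {g = g} u a d red = length≡ℓ⇒reduced (u ++ a ∷ []) ev (begin
  length (u ++ a ∷ [])         ≡⟨ trans (length-++ u) (+-comm (length u) 1) ⟩
  suc (length u)               ≡⟨ cong suc (reduced⇒length≡ℓ u red) ⟩
  suc (ℓ (g · σ a))            ≡⟨ ℓ-·σ-descent g a d ⟩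
  ℓ g                          ∎)
  where
  open ≡-Reasoning
  ev : eval (u ++ a ∷ []) ≡ g
  ev = trans (eval-∷ʳ u a) (trans (cong (_· σ a) (proj₁ red)) (·σ-·σ g a))

occurrences : ∀ {n} → Fin n → Word n → ℕ
occurrences c [] = 0
occurrences c (a ∷ w) = if does (c F.≟ a) then suc (occurrences c w) else occurrences c w

occurrences-++ : ∀ {n} (c : Fin n) u v → occurrences c (u ++ v) ≡ occurrences c u + occurrences c v
occurrences-++ c [] v = refl
occurrences-++ c (a ∷ u) v with does (c F.≟ a)
... | true = cong suc (occurrences-++ c u v)
... | false = occurrences-++ c u v

occurrences-swap : ∀ {n} (c : Fin n) a b w → occurrences c (a ∷ b ∷ w) ≡ occurrences c (b ∷ a ∷ w)
occurrences-swap c a b w with does (c F.≟ a) | does (c F.≟ b)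
... | true | true = refl
... | true | false = refl
... | false | true = refl
... | false | false = refl

occurrences-[self] : ∀ {n} (c : Fin n) → occurrences c (c ∷ []) ≡ 1
occurrences-[self] c with c F.≟ c
... | yes _ = refl
... | no c≢c = ⊥-elim (c≢c refl)

occurrences-[other] : ∀ {n} {c a : Fin n} → c ≢ a → occurrences c (a ∷ []) ≡ 0
occurrences-[other] {c = c} {a} c≢a with c F.≟ a
... | yes c≡a = ⊥-elim (c≢a c≡a)
... | no _ = refl

occurrences-∷ʳ-self : ∀ {n} (c : Fin n) w → occurrences c (w ++ c ∷ []) ≡ suc (occurrences c w)
occurrences-∷ʳ-self c w =
  trans (occurrences-++ c w (c ∷ [])) (trans (cong (occurrences c w +_) (occurrences-[self] c)) (+-comm _ 1))

occurrences-∷ʳ-other : ∀ {n} {c a : Fin n} w → c ≢ a → occurrences c (w ++ a ∷ []) ≡ occurrences c w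
occurrences-∷ʳ-other {c = c} w c≢a =
  trans (occurrences-++ c w _) (trans (cong (occurrences c w +_) (occurrences-[other] c≢a)) (+-identityʳ _))

occurrences-CommStep : ∀ {n} (c : Fin n) {w w'} → CommStep w w' → occurrences c w ≡ occurrences c w'
occurrences-CommStep c (swap xs ys a b _) = begin
  occurrences c (xs ++ a ∷ b ∷ ys)                   ≡⟨ occurrences-++ c xs _ ⟩
  occurrences c xs + occurrences c (a ∷ b ∷ ys)      ≡⟨ cong (occurrences c xs +_) (occurrences-swap c a b ys) ⟩
  occurrences c xs + occurrences c (b ∷ a ∷ ys)      ≡⟨ sym (occurrences-++ c xs _) ⟩
  occurrences c (xs ++ b ∷ a ∷ ys)                   ∎
  where open ≡-Reasoning

occurrences-Star : ∀ {n} (c : Fin n) {w w'} → Star CommStep w w' → occurrences c w ≡ occurrences c w'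
occurrences-Star c ε = refl
occurrences-Star c (s ◅ ss) = trans (occurrences-CommStep c s) (occurrences-Star c ss)

CommStep-++ʳ : ∀ {n} {u u' : Word n} s → CommStep u u' → CommStep (u ++ s) (u' ++ s)
CommStep-++ʳ s (swap xs ys a b f) =
  subst₂ CommStep (sym (++-assoc xs (a ∷ b ∷ ys) s)) (sym (++-assoc xs (b ∷ a ∷ ys) s)) (swap xs (ys ++ s) a b f)

Star-++ʳ : ∀ {n} {u u' : Word n} s → Star CommStep u u' → Star CommStep (u ++ s) (u' ++ s)
Star-++ʳ s = gmap (_++ s) (CommStep-++ʳ s)

CommutationClass : ∀ {n} → Elt n → Set
CommutationClass {n} g = ∀ (w w' : Word n) → Reduced g w → Reduced g w' → Star CommStep w w'

-- u a ∼ v b a ∼ v a b ∼ u' b, where v is a reduced word of g σ_a σ_b = g σ_b σ_a.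
CommutationClass-far-descents : ∀ {n} {g : Elt n} {a b} → IsInjective g → Far (toℕ a) (toℕ b) →
  Descent g a → Descent g b → CommutationClass (g · σ a) → CommutationClass (g · σ b) →
  ∀ u u' → Reduced (g · σ a) u → Reduced (g · σ b) u' → Star CommStep (u ++ a ∷ []) (u' ++ b ∷ [])
CommutationClass-far-descents {n} {g} {a} {b} inj far da db class-a class-b u u' ru ru'
  with Far⇒away far | Far⇒away (Far-sym far) | reduced-exists ((g · σ a) · σ b) (·σ-injective _ b (·σ-injective g a inj))
... | (b≢a , b≢1+a) , (1+b≢a , 1+b≢1+a) | (a≢b , a≢1+b) , (1+a≢b , 1+a≢1+b) | v , rv =
  Star-++ʳ (a ∷ []) (class-a u (v ++ b ∷ []) ru (Reduced-∷ʳ v b db' rv)) ◅◅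
  (middle ◅ Star-++ʳ (b ∷ []) (class-b (v ++ a ∷ []) u' (Reduced-∷ʳ v a da' (subst (λ z → Reduced z v) commute rv)) ru'))
  where
  db' : Descent (g · σ a) b
  db' = subst₂ _<_ (sym (trans (⟦⟧-·σ g a _) (cong ⟦ g ⟧ (τ-away (toℕ a) _ 1+b≢a 1+b≢1+a))))
                   (sym (trans (⟦⟧-·σ g a _) (cong ⟦ g ⟧ (τ-away (toℕ a) _ b≢a b≢1+a)))) db
  da' : Descent (g · σ b) a
  da' = subst₂ _<_ (sym (trans (⟦⟧-·σ g b _) (cong ⟦ g ⟧ (τ-away (toℕ b) _ 1+a≢b 1+a≢1+b))))
                   (sym (trans (⟦⟧-·σ g b _) (cong ⟦ g ⟧ (τ-away (toℕ b) _ a≢b a≢1+b)))) da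
  commute : (g · σ a) · σ b ≡ (g · σ b) · σ a
  commute = Elt-ext λ x _ → begin
    ⟦ (g · σ a) · σ b ⟧ x                 ≡⟨ trans (⟦⟧-·σ (g · σ a) b x) (⟦⟧-·σ g a _) ⟩
    ⟦ g ⟧ (τ (toℕ a) (τ (toℕ b) x))     ≡⟨ cong ⟦ g ⟧ (τ-comm far x) ⟩
    ⟦ g ⟧ (τ (toℕ b) (τ (toℕ a) x))     ≡⟨ sym (trans (⟦⟧-·σ (g · σ b) a x) (⟦⟧-·σ g b _)) ⟩
    ⟦ (g · σ b) · σ a ⟧ x                 ∎
    where open ≡-Reasoning
  middle : CommStep ((v ++ b ∷ []) ++ a ∷ []) ((v ++ a ∷ []) ++ b ∷ [])
  middle = subst₂ CommStep (sym (++-assoc v (b ∷ []) (a ∷ []))) (sym (++-assoc v (a ∷ []) (b ∷ [])))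
                  (swap v [] b a (Far-sym far))

Pattern321 : ℕ → (ℕ → ℕ) → ℕ → ℕ → ℕ → Set
Pattern321 N f p q r = p < q × q < r × r < N × f q < f p × f r < f q

Avoids321 : ∀ {n} → Elt n → Set
Avoids321 {n} g = ∀ p q r → ¬ Pattern321 (suc n) ⟦ g ⟧ p q r

Pattern321-τ : ∀ {N f f'} a → suc a < N → (∀ x → f' (τ a x) ≡ f x) → ∀ {p q r} → Pattern321 N f p q r →
  ¬ (p ≡ a × q ≡ suc a) → ¬ (q ≡ a × r ≡ suc a) → Pattern321 N f' (τ a p) (τ a q) (τ a r)
Pattern321-τ {N} a a<N e {p} {q} {r} (p<q , q<r , r<N , fq<fp , fr<fq) not-pq not-qr =
  τ-monotone a p<q not-pq , τ-monotone a q<r not-qr , τ-< a r a<N r<N ,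
  subst₂ _<_ (sym (e q)) (sym (e p)) fq<fp , subst₂ _<_ (sym (e r)) (sym (e q)) fr<fq

Avoids321-·σ : ∀ {n} (g : Elt n) a → Descent g a → Avoids321 g → Avoids321 (g · σ a)
Avoids321-·σ {n} g a d avoids p q r pat@(_ , _ , _ , fq<fp , fr<fq) =
  avoids _ _ _ (Pattern321-τ {f' = ⟦ g ⟧} (toℕ a) (s≤s (toℕ<n a)) (λ x → sym (⟦⟧-·σ g a x)) pat (not-at p q fq<fp) (not-at q r fr<fq))
  where
  not-at : ∀ x y → ⟦ g · σ a ⟧ y < ⟦ g · σ a ⟧ x → ¬ (x ≡ toℕ a × y ≡ suc (toℕ a))
  not-at x y lt (refl , refl) =
    <-asym d (subst₂ _<_ (trans (⟦⟧-·σ g a y) (cong ⟦ g ⟧ (τ-at-suc (toℕ a)))) (trans (⟦⟧-·σ g a x) (cong ⟦ g ⟧ (τ-at (toℕ a)))) lt)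

Avoids321⇒descents-Far : ∀ {n} (g : Elt n) → Avoids321 g → ∀ {a b} → Descent g a → Descent g b → toℕ a < toℕ b → Far (toℕ a) (toℕ b)
Avoids321⇒descents-Far {n} g avoids {a} {b} da db a<b with suc (toℕ a) ≟ toℕ b
... | no 1+a≢b = far₁ (≤∧≢⇒< a<b 1+a≢b)
... | yes 1+a≡b = ⊥-elim (avoids (toℕ a) (toℕ b) (suc (toℕ b))
  (a<b , n<1+n _ , s≤s (toℕ<n b) , subst (λ z → ⟦ g ⟧ z < ⟦ g ⟧ (toℕ a)) 1+a≡b da , db))

Avoids321⇒CommutationClass : ∀ {n} (g : Elt n) → Avoids321 g → CommutationClass g
Avoids321⇒CommutationClass g avoids = go (ℓ g) g refl avoids
  where
  go : ∀ {n} k (g : Elt n) → ℓ g ≡ k → Avoids321 g → CommutationClass g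
  go zero g ℓg≡0 avoids [] [] rw rw' = ε
  go zero g ℓg≡0 avoids [] (b ∷ w') rw rw' = ⊥-elim (1+n≢0 (trans (reduced⇒length≡ℓ (b ∷ w') rw') ℓg≡0))
  go zero g ℓg≡0 avoids (a ∷ w) w' rw rw' = ⊥-elim (1+n≢0 (trans (reduced⇒length≡ℓ (a ∷ w) rw) ℓg≡0))
  go (suc k) g ℓg≡1+k avoids w w' rw rw' with initLast w | initLast w'
  ... | [] | _ = ⊥-elim (0≢1+n (trans (reduced⇒length≡ℓ [] rw) ℓg≡1+k))
  ... | _ ∷ʳ′ _ | [] = ⊥-elim (0≢1+n (trans (reduced⇒length≡ℓ [] rw') ℓg≡1+k))
  ... | u ∷ʳ′ a | u' ∷ʳ′ b with Reduced-∷ʳ⁻ u a rw | Reduced-∷ʳ⁻ u' b rw'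
  ...   | da , ru | db , ru' = last-letters (<-cmp (toℕ a) (toℕ b))
    where
    inj : IsInjective g
    inj = InW⇒injective (u L.∷ʳ a , proj₁ rw)
    class : ∀ c → Descent g c → CommutationClass (g · σ c)
    class c dc = go k (g · σ c) (suc-injective (trans (ℓ-·σ-descent g c dc) ℓg≡1+k)) (Avoids321-·σ g c dc avoids)
    last-letters : Tri (toℕ a < toℕ b) (toℕ a ≡ toℕ b) (toℕ b < toℕ a) → Star CommStep (u ++ a ∷ []) (u' ++ b ∷ [])
    last-letters (tri≈ _ a≡b _) with toℕ-injective a≡b
    ... | refl = Star-++ʳ (a ∷ []) (class a da u u' ru ru')
    last-letters (tri< a<b _ _) =
      CommutationClass-far-descents inj (Avoids321⇒descents-Far g avoids da db a<b) da db (class a da) (class b db) u u' ru ru'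
    last-letters (tri> _ _ b<a) =
      CommutationClass-far-descents inj (Far-sym (Avoids321⇒descents-Far g avoids db da b<a)) da db (class a da) (class b db) u u' ru ru'

LetterCountsDiffer : ∀ {n} → Elt n → Set
LetterCountsDiffer {n} g =
  ∃ λ (c : Fin n) → ∃ λ w → ∃ λ w' → Reduced g w × Reduced g w' × occurrences c w ≢ occurrences c w'

LetterCountsDiffer⇒¬FC : ∀ {n} {g : Elt n} → LetterCountsDiffer g → ¬ FC g
LetterCountsDiffer⇒¬FC (c , w , w' , rw , rw' , differ) (_ , class) = differ (occurrences-Star c (class w w' rw rw'))

LetterCountsDiffer-·σ : ∀ {n} {g : Elt n} {a} → Descent g a → LetterCountsDiffer (g · σ a) → LetterCountsDiffer g
LetterCountsDiffer-·σ {g = g} {a} d (c , w , w' , rw , rw' , differ) =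
  c , w ++ a ∷ [] , w' ++ a ∷ [] , Reduced-∷ʳ w a d rw , Reduced-∷ʳ w' a d rw' ,
  λ eq → differ (+-cancelʳ-≡ (occurrences c (a ∷ [])) _ _
    (trans (sym (occurrences-++ c w (a ∷ []))) (trans eq (occurrences-++ c w' (a ∷ [])))))

module _ {n} (g : Elt n) (α β : Fin n) (β≡1+α : toℕ β ≡ suc (toℕ α)) where

  private
    e : ℕ
    e = toℕ α
    f : ℕ → ℕ
    f = ⟦ g ⟧
    ⟦⟧-·σα : ∀ h x → ⟦ h · σ α ⟧ x ≡ ⟦ h ⟧ (τ e x)
    ⟦⟧-·σα h x = ⟦⟧-·σ h α x
    ⟦⟧-·σβ : ∀ h x → ⟦ h · σ β ⟧ x ≡ ⟦ h ⟧ (τ (suc e) x)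
    ⟦⟧-·σβ h x = trans (⟦⟧-·σ h β x) (cong (λ z → ⟦ h ⟧ (τ z x)) β≡1+α)
    descent-β : ∀ {h} → ⟦ h ⟧ (suc (suc e)) < ⟦ h ⟧ (suc e) → Descent h β
    descent-β {h} = subst (λ z → ⟦ h ⟧ (suc z) < ⟦ h ⟧ z) (sym β≡1+α)

  ·σ-braid : ((g · σ α) · σ β) · σ α ≡ ((g · σ β) · σ α) · σ β
  ·σ-braid = Elt-ext λ x _ → begin
    ⟦ ((g · σ α) · σ β) · σ α ⟧ x       ≡⟨ trans (⟦⟧-·σα _ x) (trans (⟦⟧-·σβ _ _) (⟦⟧-·σα g _)) ⟩
    f (τ e (τ (suc e) (τ e x)))         ≡⟨ cong f (τ-braid e x) ⟩
    f (τ (suc e) (τ e (τ (suc e) x)))   ≡⟨ sym (trans (⟦⟧-·σβ _ x) (trans (⟦⟧-·σα _ _) (⟦⟧-·σβ g _))) ⟩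
    ⟦ ((g · σ β) · σ α) · σ β ⟧ x       ∎
    where open ≡-Reasoning

  -- Both α β α and β α β can be cancelled from the right of g: f e > f (e+1) > f (e+2).
  braid-descents : Descent g α → Descent g β →
    Descent (g · σ α) β × Descent ((g · σ α) · σ β) α × Descent (g · σ β) α × Descent ((g · σ β) · σ α) β
  braid-descents d₀₁ dβ =
    descent-β (subst₂ _<_ (sym (trans (⟦⟧-·σα g _) (cong f (τ-at-suc-suc e))))
                          (sym (trans (⟦⟧-·σα g _) (cong f (τ-at-suc e)))) d₀₂) ,
    subst₂ _<_ (sym (trans (⟦⟧-·σβ _ _) (trans (⟦⟧-·σα g _) (trans (cong (f ∘ τ e) (τ-at (suc e))) (cong f (τ-at-suc-suc e))))))
               (sym (trans (⟦⟧-·σβ _ _) (trans (⟦⟧-·σα g _) (trans (cong (f ∘ τ e) (τ-suc-at e)) (cong f (τ-at e)))))) d₁₂ ,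
    subst₂ _<_ (sym (trans (⟦⟧-·σβ g _) (cong f (τ-at (suc e))))) (sym (trans (⟦⟧-·σβ g _) (cong f (τ-suc-at e)))) d₀₂ ,
    descent-β (subst₂ _<_
      (sym (trans (⟦⟧-·σα _ _) (trans (⟦⟧-·σβ g _) (trans (cong (f ∘ τ (suc e)) (τ-at-suc-suc e)) (cong f (τ-at-suc (suc e)))))))
      (sym (trans (⟦⟧-·σα _ _) (trans (⟦⟧-·σβ g _) (trans (cong (f ∘ τ (suc e)) (τ-at-suc e)) (cong f (τ-suc-at e)))))) d₀₁)
    where
    d₁₂ : f (suc (suc e)) < f (suc e)
    d₁₂ = subst (λ z → f (suc z) < f z) β≡1+α dβ
    d₀₂ : f (suc (suc e)) < f e
    d₀₂ = <-trans d₁₂ d₀₁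

  -- v α β α and v β α β are reduced words of g with different numbers of α.
  LetterCountsDiffer-braid : IsInjective g → Descent g α → Descent g β → LetterCountsDiffer g
  LetterCountsDiffer-braid inj dα dβ with braid-descents dα dβ | reduced-exists (((g · σ α) · σ β) · σ α)
                                                   (·σ-injective _ α (·σ-injective _ β (·σ-injective g α inj)))
  ... | dαβ , dαβα , dβα , dβαβ | v , rv =
    α , ((v ++ α ∷ []) ++ β ∷ []) ++ α ∷ [] , ((v ++ β ∷ []) ++ α ∷ []) ++ β ∷ [] ,
    Reduced-∷ʳ ((v ++ α ∷ []) ++ β ∷ []) α dα (Reduced-∷ʳ (v ++ α ∷ []) β dαβ (Reduced-∷ʳ v α dαβα rv)) ,
    Reduced-∷ʳ ((v ++ β ∷ []) ++ α ∷ []) β dβ (Reduced-∷ʳ (v ++ β ∷ []) α dβα (Reduced-∷ʳ v β dβαβ (subst (λ z → Reduced z v) ·σ-braid rv))) ,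
    λ eq → 1+n≢n (trans (sym count-αβα) (trans eq count-βαβ))
    where
    α≢β : α ≢ β
    α≢β α≡β = 1+n≢n (sym (trans (cong toℕ α≡β) β≡1+α))
    count-αβα : occurrences α (((v ++ α ∷ []) ++ β ∷ []) ++ α ∷ []) ≡ suc (suc (occurrences α v))
    count-αβα = trans (occurrences-∷ʳ-self α ((v ++ α ∷ []) ++ β ∷ []))
                  (cong suc (trans (occurrences-∷ʳ-other (v ++ α ∷ []) α≢β) (occurrences-∷ʳ-self α v)))
    count-βαβ : occurrences α (((v ++ β ∷ []) ++ α ∷ []) ++ β ∷ []) ≡ suc (occurrences α v)
    count-βαβ = trans (occurrences-∷ʳ-other ((v ++ β ∷ []) ++ α ∷ []) α≢β)
                  (trans (occurrences-∷ʳ-self α (v ++ β ∷ [])) (cong suc (occurrences-∷ʳ-other v α≢β)))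
descent-between : ∀ (f : ℕ → ℕ) {p q} → p < q → f q < f p → ∃ λ e → p ≤ e × e < q × f (suc e) < f e
descent-between f {p} {suc q} p<1+q fq<fp with f (suc q) <? f q
... | yes d = q , s≤s⁻¹ p<1+q , n<1+n q , d
... | no ¬d with m≤n⇒m<n∨m≡n (s≤s⁻¹ p<1+q)
...   | inj₂ refl = ⊥-elim (¬d fq<fp)
...   | inj₁ p<q with descent-between f p<q (≤-<-trans (≮⇒≥ ¬d) fq<fp)
...     | e , p≤e , e<q , d = e , p≤e , m<n⇒m<1+n e<q , d

descent-between-letters : ∀ {n} (g : Elt n) {p q} → p < q → q ≤ n → ⟦ g ⟧ q < ⟦ g ⟧ p →
  ∃ λ a → p ≤ toℕ a × toℕ a < q × Descent g a
descent-between-letters {n} g p<q q≤n fq<fp with descent-between ⟦ g ⟧ p<q fq<fp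
... | e , p≤e , e<q , d = fromℕ< e<n , subst (_ ≤_) (sym toℕα≡e) p≤e , subst (_< _) (sym toℕα≡e) e<q ,
                           subst (λ z → ⟦ g ⟧ (suc z) < ⟦ g ⟧ z) (sym toℕα≡e) d
  where
  e<n : e < n
  e<n = <-≤-trans e<q q≤n
  toℕα≡e : toℕ (fromℕ< e<n) ≡ e
  toℕα≡e = toℕ-fromℕ< e<n

Pattern321-·σ : ∀ {n} (g : Elt n) a {p q r} → Pattern321 (suc n) ⟦ g ⟧ p q r →
  ¬ (p ≡ toℕ a × q ≡ suc (toℕ a)) → ¬ (q ≡ toℕ a × r ≡ suc (toℕ a)) →
  Pattern321 (suc n) ⟦ g · σ a ⟧ (τ (toℕ a) p) (τ (toℕ a) q) (τ (toℕ a) r)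
Pattern321-·σ g a = Pattern321-τ {f' = ⟦ g · σ a ⟧} (toℕ a) (s≤s (toℕ<n a)) (λ x → trans (⟦⟧-·σ g a _) (cong ⟦ g ⟧ (τ-involutive (toℕ a) x)))

-- Take descents a ∈ [p, q) and b ∈ [q, r). Unless p = a, q = a + 1 = b and r = b + 1, one of them
-- can be cancelled from the right keeping a 321-pattern; in that last case the braid relation applies.
Pattern321-step : ∀ {n} (g : Elt n) → IsInjective g →
  (∀ a → Descent g a → ∀ {p q r} → Pattern321 (suc n) ⟦ g · σ a ⟧ p q r → LetterCountsDiffer (g · σ a)) →
  ∀ {p q r} → Pattern321 (suc n) ⟦ g ⟧ p q r → LetterCountsDiffer g
Pattern321-step {n} g inj rec {p} {q} {r} pat@(p<q , q<r , r<1+n , fq<fp , fr<fq)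
  with descent-between-letters g p<q (<⇒≤ (<-≤-trans q<r (s≤s⁻¹ r<1+n))) fq<fp
     | descent-between-letters g q<r (s≤s⁻¹ r<1+n) fr<fq
... | a , _ , a<q , da | b , q≤b , _ , db with (p ≟ toℕ a ×-dec q ≟ suc (toℕ a)) | (q ≟ toℕ b ×-dec r ≟ suc (toℕ b))
...   | no not-pq | _ =
  LetterCountsDiffer-·σ da (rec a da (Pattern321-·σ g a pat not-pq (λ (q≡a , _) → <-irrefl (sym q≡a) a<q)))
...   | yes _ | no not-qr =
  LetterCountsDiffer-·σ db (rec b db (Pattern321-·σ g b pat (λ (p≡b , _) → <-irrefl p≡b (<-≤-trans p<q q≤b)) not-qr))
...   | yes (_ , q≡1+a) | yes (q≡b , _) = LetterCountsDiffer-braid g a b (trans (sym q≡b) q≡1+a) inj da db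

Pattern321⇒LetterCountsDiffer : ∀ {n} (g : Elt n) → IsInjective g → ∀ {p q r} → Pattern321 (suc n) ⟦ g ⟧ p q r → LetterCountsDiffer g
Pattern321⇒LetterCountsDiffer g inj = go (ℓ g) g inj refl
  where
  go : ∀ {n} k (g : Elt n) → IsInjective g → ℓ g ≡ k → ∀ {p q r} → Pattern321 (suc n) ⟦ g ⟧ p q r → LetterCountsDiffer g
  go zero g inj ℓg≡0 pat@(p<q , q<r , r<1+n , fq<fp , _) with descent-between-letters g p<q (<⇒≤ (<-≤-trans q<r (s≤s⁻¹ r<1+n))) fq<fp
  ... | a , _ , _ , da = ⊥-elim (1+n≢0 (trans (ℓ-·σ-descent g a da) ℓg≡0))
  go (suc k) g inj ℓg≡1+k = Pattern321-step g inj λ a da →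
    go k (g · σ a) (·σ-injective g a inj) (suc-injective (trans (ℓ-·σ-descent g a da) ℓg≡1+k))

FC⇒Avoids321 : ∀ {n} (g : Elt n) → FC g → Avoids321 g
FC⇒Avoids321 g fc p q r pat = LetterCountsDiffer⇒¬FC (Pattern321⇒LetterCountsDiffer g (InW⇒injective (proj₁ fc)) pat) fc

Avoids321⇒FC : ∀ {n} (g : Elt n) → IsInjective g → Avoids321 g → FC g
Avoids321⇒FC g inj avoids with reduced-exists g inj
... | w , rw = (w , proj₁ rw) , Avoids321⇒CommutationClass g avoids

-- The action of the segment [s+1, j] = σ_{s+1} ⋯ σ_j: the cycle j ↦ s ↦ s+1 ↦ ⋯ ↦ j.
opaque
  cycle : ℕ → ℕ → ℕ → ℕ
  cycle s j x with x ≟ j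
  ... | yes _ = s
  ... | no _ with s ≤? x | x <? j
  ...   | yes _ | yes _ = suc x
  ...   | _ | _ = x

  cycle-top : ∀ s j → cycle s j j ≡ s
  cycle-top s j with j ≟ j
  ... | yes _ = refl
  ... | no j≢j = ⊥-elim (j≢j refl)

  cycle-inside : ∀ {s j x} → s ≤ x → x < j → cycle s j x ≡ suc x
  cycle-inside {s} {j} {x} s≤x x<j with x ≟ j
  ... | yes x≡j = ⊥-elim (<-irrefl x≡j x<j)
  ... | no _ with s ≤? x | x <? j
  ...   | yes _ | yes _ = refl
  ...   | no s≰x | _ = ⊥-elim (s≰x s≤x)
  ...   | yes _ | no x≮j = ⊥-elim (x≮j x<j)

  cycle-below : ∀ {s j x} → x ≢ j → x < s → cycle s j x ≡ x
  cycle-below {s} {j} {x} x≢j x<s with x ≟ j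
  ... | yes x≡j = ⊥-elim (x≢j x≡j)
  ... | no _ with s ≤? x | x <? j
  ...   | yes s≤x | yes _ = ⊥-elim (<⇒≱ x<s s≤x)
  ...   | no _ | yes _ = refl
  ...   | yes _ | no _ = refl
  ...   | no _ | no _ = refl

  cycle-above : ∀ {s j x} → j < x → cycle s j x ≡ x
  cycle-above {s} {j} {x} j<x with x ≟ j
  ... | yes x≡j = ⊥-elim (<-irrefl (sym x≡j) j<x)
  ... | no _ with s ≤? x | x <? j
  ...   | yes _ | yes x<j = ⊥-elim (<-asym x<j j<x)
  ...   | no _ | yes _ = refl
  ...   | yes _ | no _ = refl
  ...   | no _ | no _ = refl

cycle-empty : ∀ s x → cycle s s x ≡ x
cycle-empty s x with <-cmp x s
... | tri< x<s _ _ = cycle-below (<⇒≢ x<s) x<s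
... | tri≈ _ refl _ = cycle-top s s
... | tri> _ _ s<x = cycle-above s<x

cycle-extend : ∀ {s} j x → s ≤ j → cycle s j (τ j x) ≡ cycle s (suc j) x
cycle-extend {s} j x s≤j with τ-case j x
... | at refl = trans (cong (cycle s x) (τ-at x)) (trans (cycle-above (n<1+n x)) (sym (cycle-inside s≤j (n<1+n x))))
... | at-suc refl = trans (cong (cycle s j) (τ-at-suc j)) (trans (cycle-top s j) (sym (cycle-top s (suc j))))
... | away x≢j x≢1+j with <-cmp x j
...   | tri≈ _ x≡j _ = ⊥-elim (x≢j x≡j)
...   | tri> _ _ j<x = trans (cong (cycle s j) (τ-away j x x≢j x≢1+j)) (trans (cycle-above j<x)
                         (sym (cycle-above (≤∧≢⇒< j<x (x≢1+j ∘ sym)))))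
...   | tri< x<j _ _ with s ≤? x
...     | yes s≤x = trans (cong (cycle s j) (τ-away j x x≢j x≢1+j))
                      (trans (cycle-inside s≤x x<j) (sym (cycle-inside s≤x (m<n⇒m<1+n x<j))))
...     | no s≰x = trans (cong (cycle s j) (τ-away j x x≢j x≢1+j))
                      (trans (cycle-below x≢j (≰⇒> s≰x)) (sym (cycle-below x≢1+j (≰⇒> s≰x))))

⟦_⟧ᴺ : List ℕ → ℕ → ℕ
⟦ [] ⟧ᴺ x = x
⟦ a ∷ w ⟧ᴺ x = τ a (⟦ w ⟧ᴺ x)

⟦⟧ᴺ-∷ʳ : ∀ u a x → ⟦ u ++ a ∷ [] ⟧ᴺ x ≡ ⟦ u ⟧ᴺ (τ a x)
⟦⟧ᴺ-∷ʳ [] a x = refl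
⟦⟧ᴺ-∷ʳ (b ∷ u) a x = cong (τ b) (⟦⟧ᴺ-∷ʳ u a x)

⟦⟧ʷ-map-toℕ : ∀ {n} (w : Word n) x → ⟦ w ⟧ʷ x ≡ ⟦ L.map toℕ w ⟧ᴺ x
⟦⟧ʷ-map-toℕ [] x = refl
⟦⟧ʷ-map-toℕ (a ∷ w) x = cong (τ (toℕ a)) (⟦⟧ʷ-map-toℕ w x)

map-filter : ∀ {A B : Set} {P : B → Set} (f : A → B) (P? : ∀ b → Dec (P b)) xs →
  L.map f (L.filter (P? ∘ f) xs) ≡ L.filter P? (L.map f xs)
map-filter f P? [] = refl
map-filter f P? (x ∷ xs) with does (P? (f x))
... | true = cong (f x ∷_) (map-filter f P? xs)
... | false = map-filter f P? xs

map-toℕ-allFin : ∀ n → L.map toℕ (L.allFin n) ≡ L.upTo n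
map-toℕ-allFin n = trans (map-tabulate (λ i → i) toℕ) (tabulate-toℕ n (λ i → i))
  where
  tabulate-toℕ : ∀ n (f : ℕ → ℕ) → L.tabulate {n = n} (f ∘ toℕ) ≡ L.applyUpTo f n
  tabulate-toℕ zero f = refl
  tabulate-toℕ (suc n) f = cong (f 0 ∷_) (tabulate-toℕ n (f ∘ suc))

inSegment? : ∀ (i j k : ℕ) → Dec (i ≤ suc k × suc k ≤ j)
inSegment? i j k = (i ≤? suc k) ×-dec (suc k ≤? j)

map-toℕ-seg : ∀ {n} i j → L.map toℕ (seg {n} i j) ≡ L.filter (inSegment? i j) (L.upTo n)
map-toℕ-seg {n} i j = trans (map-filter toℕ (inSegment? i j) (L.allFin n)) (cong (L.filter (inSegment? i j)) (map-toℕ-allFin n))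

filter-upTo-suc : ∀ {P : ℕ → Set} (P? : ∀ k → Dec (P k)) n → L.filter P? (L.upTo (suc n)) ≡ L.filter P? (L.upTo n) ++ L.filter P? (n ∷ [])
filter-upTo-suc P? n = trans (cong (L.filter P?) (sym (upTo-∷ʳ n))) (filter-++ P? (L.upTo n) (n ∷ []))

segment-upTo-below : ∀ s j n → n ≤ s → L.filter (inSegment? (suc s) j) (L.upTo n) ≡ []
segment-upTo-below s j zero _ = refl
segment-upTo-below s j (suc n) n<s = begin
  L.filter (inSegment? (suc s) j) (L.upTo (suc n))
    ≡⟨ filter-upTo-suc (inSegment? (suc s) j) n ⟩
  L.filter (inSegment? (suc s) j) (L.upTo n) ++ L.filter (inSegment? (suc s) j) (n ∷ [])
    ≡⟨ cong₂ _++_ (segment-upTo-below s j n (≤-trans (n≤1+n n) n<s)) (filter-reject (inSegment? (suc s) j) (λ (s<n , _) → <⇒≱ n<s (s≤s⁻¹ s<n))) ⟩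
  [] ∎
  where open ≡-Reasoning

segment-upTo-above : ∀ i j d → L.filter (inSegment? i j) (L.upTo (j + d)) ≡ L.filter (inSegment? i j) (L.upTo j)
segment-upTo-above i j zero = cong (λ z → L.filter (inSegment? i j) (L.upTo z)) (+-identityʳ j)
segment-upTo-above i j (suc d) = begin
  L.filter (inSegment? i j) (L.upTo (j + suc d))
    ≡⟨ cong (λ z → L.filter (inSegment? i j) (L.upTo z)) (+-suc j d) ⟩
  L.filter (inSegment? i j) (L.upTo (suc (j + d)))
    ≡⟨ filter-upTo-suc (inSegment? i j) (j + d) ⟩
  L.filter (inSegment? i j) (L.upTo (j + d)) ++ L.filter (inSegment? i j) (j + d ∷ [])
    ≡⟨ cong (L.filter (inSegment? i j) (L.upTo (j + d)) ++_) (filter-reject (inSegment? i j) (λ (_ , j+d<j) → 1+n≰n (≤-trans (s≤s (m≤m+n j d)) j+d<j))) ⟩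
  L.filter (inSegment? i j) (L.upTo (j + d)) ++ []
    ≡⟨ ++-identityʳ _ ⟩
  L.filter (inSegment? i j) (L.upTo (j + d))
    ≡⟨ segment-upTo-above i j d ⟩
  L.filter (inSegment? i j) (L.upTo j) ∎
  where open ≡-Reasoning

⟦segment-upTo⟧ᴺ : ∀ s j n → n ≤ j → s ≤ n → ∀ x → ⟦ L.filter (inSegment? (suc s) j) (L.upTo n) ⟧ᴺ x ≡ cycle s n x
⟦segment-upTo⟧ᴺ s j zero _ z≤n x = sym (cycle-empty 0 x)
⟦segment-upTo⟧ᴺ s j (suc n) 1+n≤j s≤1+n x with m≤n⇒m<n∨m≡n s≤1+n
... | inj₂ refl = trans (cong (λ z → ⟦ z ⟧ᴺ x) (segment-upTo-below s j (suc n) ≤-refl)) (sym (cycle-empty (suc n) x))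
... | inj₁ s<1+n = begin
  ⟦ L.filter (inSegment? (suc s) j) (L.upTo (suc n)) ⟧ᴺ x
    ≡⟨ cong (λ z → ⟦ z ⟧ᴺ x) (filter-upTo-suc (inSegment? (suc s) j) n) ⟩
  ⟦ L.filter (inSegment? (suc s) j) (L.upTo n) ++ L.filter (inSegment? (suc s) j) (n ∷ []) ⟧ᴺ x
    ≡⟨ cong (λ z → ⟦ L.filter (inSegment? (suc s) j) (L.upTo n) ++ z ⟧ᴺ x) (filter-accept (inSegment? (suc s) j) (s<1+n , 1+n≤j)) ⟩
  ⟦ L.filter (inSegment? (suc s) j) (L.upTo n) ++ n ∷ [] ⟧ᴺ x
    ≡⟨ ⟦⟧ᴺ-∷ʳ (L.filter (inSegment? (suc s) j) (L.upTo n)) n x ⟩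
  ⟦ L.filter (inSegment? (suc s) j) (L.upTo n) ⟧ᴺ (τ n x)
    ≡⟨ ⟦segment-upTo⟧ᴺ s j n (≤-trans (n≤1+n n) 1+n≤j) (s≤s⁻¹ s<1+n) (τ n x) ⟩
  cycle s n (τ n x)
    ≡⟨ cycle-extend n x (s≤s⁻¹ s<1+n) ⟩
  cycle s (suc n) x ∎
  where open ≡-Reasoning

⟦⟧ʷ-seg : ∀ {n} {s j} → s ≤ j → j ≤ n → ∀ x → ⟦ seg {n} (suc s) j ⟧ʷ x ≡ cycle s j x
⟦⟧ʷ-seg {n} {s} {j} s≤j j≤n x = begin
  ⟦ seg {n} (suc s) j ⟧ʷ x                                          ≡⟨ ⟦⟧ʷ-map-toℕ (seg {n} (suc s) j) x ⟩
  ⟦ L.map toℕ (seg {n} (suc s) j) ⟧ᴺ x                              ≡⟨ cong (λ z → ⟦ z ⟧ᴺ x) (map-toℕ-seg {n} (suc s) j) ⟩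
  ⟦ L.filter (inSegment? (suc s) j) (L.upTo n) ⟧ᴺ x                 ≡⟨ cong (λ z → ⟦ L.filter (inSegment? (suc s) j) (L.upTo z) ⟧ᴺ x) (sym (m+[n∸m]≡n j≤n)) ⟩
  ⟦ L.filter (inSegment? (suc s) j) (L.upTo (j + (n ∸ j))) ⟧ᴺ x     ≡⟨ cong (λ z → ⟦ z ⟧ᴺ x) (segment-upTo-above (suc s) j (n ∸ j)) ⟩
  ⟦ L.filter (inSegment? (suc s) j) (L.upTo j) ⟧ᴺ x                 ≡⟨ ⟦segment-upTo⟧ᴺ s j j ≤-refl s≤j x ⟩
  cycle s j x                                                       ∎
  where open ≡-Reasoning

data Cycle-Case (s j x : ℕ) : Set where
  top    : x ≡ j → Cycle-Case s j x
  below  : x ≢ j → x < s → Cycle-Case s j x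
  inside : s ≤ x → x < j → Cycle-Case s j x
  above  : j < x → Cycle-Case s j x

cycle-case : ∀ s j x → Cycle-Case s j x
cycle-case s j x with <-cmp x j | x <? s
... | tri≈ _ x≡j _ | _ = top x≡j
... | tri> _ _ j<x | _ = above j<x
... | tri< x<j _ _ | yes x<s = below (<⇒≢ x<j) x<s
... | tri< x<j _ _ | no x≮s = inside (≮⇒≥ x≮s) x<j

cycle-monotone-below : ∀ {s j y y'} → y < y' → y' < j → cycle s j y < cycle s j y'
cycle-monotone-below {s} {j} {y} {y'} y<y' y'<j with y' <? s | y <? s
... | yes y'<s | _ = subst₂ _<_ (sym (cycle-below (<⇒≢ (<-trans y<y' y'<j)) (<-trans y<y' y'<s))) (sym (cycle-below (<⇒≢ y'<j) y'<s)) y<y'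
... | no y'≮s | yes y<s = subst₂ _<_ (sym (cycle-below (<⇒≢ (<-trans y<y' y'<j)) y<s)) (sym (cycle-inside (≮⇒≥ y'≮s) y'<j)) (m<n⇒m<1+n y<y')
... | no y'≮s | no y≮s = subst₂ _<_ (sym (cycle-inside (≮⇒≥ y≮s) (<-trans y<y' y'<j))) (sym (cycle-inside (≮⇒≥ y'≮s) y'<j)) (s≤s y<y')

cycle-reflects-<-below : ∀ {s j y y'} → y < j → y' < j → cycle s j y < cycle s j y' → y < y'
cycle-reflects-<-below {y = y} {y'} y<j y'<j lt with <-cmp y y'
... | tri< y<y' _ _ = y<y'
... | tri≈ _ refl _ = ⊥-elim (<-irrefl refl lt)
... | tri> _ _ y'<y = ⊥-elim (<-asym lt (cycle-monotone-below y'<y y<j))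

cycle-increasing-above : ∀ {s j p q} → p < q → suc s ≤ cycle s j q → cycle s j p < cycle s j q
cycle-increasing-above {s} {j} {p} {q} p<q s<cq with cycle-case s j q | cycle-case s j p
... | top refl | _ = ⊥-elim (1+n≰n (subst (suc s ≤_) (cycle-top s j) s<cq))
... | below q≢j q<s | _ = ⊥-elim (1+n≰n (≤-trans (subst (suc s ≤_) (cycle-below q≢j q<s) s<cq) (<⇒≤ q<s)))
... | inside s≤q q<j | top refl = ⊥-elim (<-asym p<q q<j)
... | inside s≤q q<j | below p≢j p<s rewrite cycle-below p≢j p<s | cycle-inside s≤q q<j = m<n⇒m<1+n p<q
... | inside s≤q q<j | inside s≤p p<j rewrite cycle-inside s≤p p<j | cycle-inside s≤q q<j = s≤s p<q
... | inside s≤q q<j | above j<p = ⊥-elim (<-asym (<-trans j<p p<q) q<j)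
... | above j<q | top refl rewrite cycle-top s j | cycle-above {s} j<q = s<cq
... | above j<q | below p≢j p<s rewrite cycle-below p≢j p<s | cycle-above {s} j<q = p<q
... | above j<q | inside s≤p p<j rewrite cycle-inside s≤p p<j | cycle-above {s} j<q = ≤-<-trans p<j j<q
... | above j<q | above j<p rewrite cycle-above {s} j<p | cycle-above {s} j<q = p<q

cycle-inversion-above : ∀ {s j a b} → suc s ≤ cycle s j b → cycle s j b < cycle s j a → s ≤ b × b < a
cycle-inversion-above {s} {j} {a} {b} s<cb cb<ca = s≤b , b<a
  where
  s≤b : s ≤ b
  s≤b with cycle-case s j b
  ... | top refl = ⊥-elim (1+n≰n (subst (suc s ≤_) (cycle-top s j) s<cb))
  ... | below b≢j b<s = ⊥-elim (1+n≰n (≤-trans (subst (suc s ≤_) (cycle-below b≢j b<s) s<cb) (<⇒≤ b<s)))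
  ... | inside s≤b _ = s≤b
  ... | above j<b with b <? s
  ...   | yes b<s = ⊥-elim (1+n≰n (≤-trans (subst (suc s ≤_) (cycle-above j<b) s<cb) (<⇒≤ b<s)))
  ...   | no b≮s = ≮⇒≥ b≮s
  b<a : b < a
  b<a with <-cmp b a
  ... | tri< b<a _ _ = b<a
  ... | tri≈ _ refl _ = ⊥-elim (<-irrefl refl cb<ca)
  ... | tri> _ _ a<b = ⊥-elim (<-asym cb<ca (cycle-increasing-above a<b s<cb))

IsInjective-· : ∀ {n} {g h : Elt n} → IsInjective g → IsInjective h → IsInjective (g · h)
IsInjective-· {g = g} {h} inj-g inj-h {x} {y} e = inj-h (inj-g (trans (sym (⟦⟧-· g h x)) (trans e (⟦⟧-· g h y))))

IsInjective-ι : ∀ {m} {h : Elt m} → IsInjective h → IsInjective (ι h)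
IsInjective-ι {h = h} inj {x} {y} e = inj (trans (sym (⟦⟧-ι h x)) (trans e (⟦⟧-ι h y)))

IsInjective-ι⁻ : ∀ {m} {h : Elt m} → IsInjective (ι h) → IsInjective h
IsInjective-ι⁻ {h = h} inj {x} {y} e = inj (trans (⟦⟧-ι h x) (trans e (sym (⟦⟧-ι h y))))

ι-one : ∀ {m} → ι (one {m}) ≡ one
ι-one = Elt-ext λ x _ → trans (⟦⟧-ι one x) (trans (⟦⟧-one x) (sym (⟦⟧-one x)))

Avoids321-ι⁻ : ∀ {m} (h : Elt m) → Avoids321 (ι h) → Avoids321 h
Avoids321-ι⁻ h avoids p q r (p<q , q<r , r<1+m , fq<fp , fr<fq) = avoids p q r
  (p<q , q<r , m<n⇒m<1+n r<1+m , subst₂ _<_ (sym (⟦⟧-ι h q)) (sym (⟦⟧-ι h p)) fq<fp , subst₂ _<_ (sym (⟦⟧-ι h r)) (sym (⟦⟧-ι h q)) fr<fq)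

Avoids321-ι : ∀ {m} (h : Elt m) → Avoids321 h → Avoids321 (ι h)
Avoids321-ι {m} h avoids p q r (p<q , q<r , r<2+m , fq<fp , fr<fq) with m≤n⇒m<n∨m≡n (s≤s⁻¹ r<2+m)
... | inj₁ r<1+m = avoids p q r
  (p<q , q<r , r<1+m , subst₂ _<_ (⟦⟧-ι h q) (⟦⟧-ι h p) fq<fp , subst₂ _<_ (⟦⟧-ι h r) (⟦⟧-ι h q) fr<fq)
... | inj₂ refl = <-asym (⟦⟧-< h q<r) (subst₂ _<_ (trans (⟦⟧-ι h (suc m)) (⟦⟧-beyond h ≤-refl)) (⟦⟧-ι h q) fr<fq)

fixes-last⇒ι : ∀ {m} (g : Elt (suc m)) → IsInjective g → ⟦ g ⟧ (suc m) ≡ suc m → ∃ λ h → g ≡ ι h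
fixes-last⇒ι {m} g inj fixes = h , sym (Elt-ext λ x _ → trans (⟦⟧-ι h x) (⟦h⟧ x))
  where
  value< : ∀ (y : Fin (suc m)) → ⟦ g ⟧ (toℕ y) < suc m
  value< y = ≤∧≢⇒< (s≤s⁻¹ (⟦⟧-< g (m<n⇒m<1+n (toℕ<n y)))) (λ e → <-irrefl (inj (trans e (sym fixes))) (toℕ<n y))
  h : Elt m
  h = V.tabulate (λ y → fromℕ< (value< y))
  ⟦h⟧ : ∀ x → ⟦ h ⟧ x ≡ ⟦ g ⟧ x
  ⟦h⟧ x with <-cmp x (suc m)
  ... | tri< x<1+m _ _ = begin
    ⟦ h ⟧ x                                  ≡⟨ ⟦⟧-fromℕ< h x<1+m ⟩
    toℕ (lookup h (fromℕ< x<1+m))            ≡⟨ cong toℕ (lookup∘tabulate (λ y → fromℕ< (value< y)) (fromℕ< x<1+m)) ⟩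
    toℕ (fromℕ< (value< (fromℕ< x<1+m)))      ≡⟨ toℕ-fromℕ< (value< (fromℕ< x<1+m)) ⟩
    ⟦ g ⟧ (toℕ (fromℕ< x<1+m))               ≡⟨ cong ⟦ g ⟧ (toℕ-fromℕ< x<1+m) ⟩
    ⟦ g ⟧ x                                  ∎
    where open ≡-Reasoning
  ... | tri≈ _ refl _ = trans (⟦⟧-beyond h ≤-refl) (sym fixes)
  ... | tri> _ _ m<x = trans (⟦⟧-beyond h (<⇒≤ m<x)) (sym (⟦⟧-beyond g m<x))

module _ {m s : ℕ} (s≤m : s ≤ m) where

  ⟦⟧-seg·ι : ∀ (h : Elt m) x → ⟦ eval (seg {suc m} (suc s) (suc m)) · ι h ⟧ x ≡ cycle s (suc m) (⟦ h ⟧ x)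
  ⟦⟧-seg·ι h x = trans (⟦⟧-· _ (ι h) x)
    (trans (⟦⟧-eval (seg (suc s) (suc m)) _) (trans (⟦⟧ʷ-seg (m≤n⇒m≤1+n s≤m) ≤-refl _) (cong (cycle s (suc m)) (⟦⟧-ι h x))))

  -- Strip the last position with the inverse segment; what remains fixes suc m.
  seg·ι-decomposition : ∀ (g : Elt (suc m)) → IsInjective g → ⟦ g ⟧ (suc m) ≡ s →
    ∃ λ h → g ≡ eval (seg {suc m} (suc s) (suc m)) · ι h
  seg·ι-decomposition g inj gm≡s with fixes-last⇒ι (eval (reverse S) · g) (IsInjective-· (eval-injective (reverse S)) inj) fixes
    where
    S : Word (suc m)
    S = seg {suc m} (suc s) (suc m)
    fixes : ⟦ eval (reverse S) · g ⟧ (suc m) ≡ suc m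
    fixes = begin
      ⟦ eval (reverse S) · g ⟧ (suc m)       ≡⟨ trans (⟦⟧-· _ g _) (⟦⟧-eval (reverse S) _) ⟩
      ⟦ reverse S ⟧ʷ (⟦ g ⟧ (suc m))         ≡⟨ cong ⟦ reverse S ⟧ʷ (trans gm≡s (sym (trans (⟦⟧ʷ-seg (m≤n⇒m≤1+n s≤m) ≤-refl _) (cycle-top s (suc m))))) ⟩
      ⟦ reverse S ⟧ʷ (⟦ S ⟧ʷ (suc m))        ≡⟨ ⟦⟧ʷ-reverse-inverseˡ S (suc m) ⟩
      suc m                                  ∎
      where open ≡-Reasoning
  ... | h , g'≡ιh = h , Elt-ext λ x _ → begin
      ⟦ g ⟧ x                                            ≡⟨ sym (⟦⟧ʷ-reverse-inverseʳ S (⟦ g ⟧ x)) ⟩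
      ⟦ S ⟧ʷ (⟦ reverse S ⟧ʷ (⟦ g ⟧ x))                  ≡⟨ sym (trans (⟦⟧-eval S _) (cong ⟦ S ⟧ʷ (trans (⟦⟧-· _ g x) (⟦⟧-eval (reverse S) _)))) ⟩
      ⟦ eval S ⟧ (⟦ eval (reverse S) · g ⟧ x)            ≡⟨ cong (λ z → ⟦ eval S ⟧ (⟦ z ⟧ x)) g'≡ιh ⟩
      ⟦ eval S ⟧ (⟦ ι h ⟧ x)                             ≡⟨ sym (⟦⟧-· (eval S) (ι h) x) ⟩
      ⟦ eval S · ι h ⟧ x                                 ∎
    where
    open ≡-Reasoning
    S : Word (suc m)
    S = seg {suc m} (suc s) (suc m)

NoInversionAbove : ℕ → ℕ → (ℕ → ℕ) → Set
NoInversionAbove v N f = ∀ {p q} → p < q → q < N → v ≤ f q → ¬ f q < f p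

NoInversionAbove-one : ∀ {n} v N → NoInversionAbove v N ⟦ one {n} ⟧
NoInversionAbove-one v N p<q _ _ lt = <-asym p<q (subst₂ _<_ (⟦⟧-one _) (⟦⟧-one _) lt)

NoInversionAbove-weaken : ∀ {v v' N f} → v ≤ v' → NoInversionAbove v N f → NoInversionAbove v' N f
NoInversionAbove-weaken v≤v' no-inversion p<q q<N v'≤fq = no-inversion p<q q<N (≤-trans v≤v' v'≤fq)

NoInversionAbove-cong : ∀ {v N f f'} → (∀ x → f x ≡ f' x) → NoInversionAbove v N f → NoInversionAbove v N f'
NoInversionAbove-cong {f = f} {f'} f≗f' no-inversion {p} {q} p<q q<N v≤fq fq<fp =
  no-inversion p<q q<N (subst (_ ≤_) (sym (f≗f' q)) v≤fq) (subst₂ _<_ (sym (f≗f' q)) (sym (f≗f' p)) fq<fp)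

-- With g = [s+1, m+1] · ι h, a 321-pattern of g ending at position m+1 (where g takes the value s)
-- is exactly an inversion of h whose smaller value is at least s.
module _ {m s : ℕ} (s≤m : s ≤ m) (h : Elt m) where

  private
    g : Elt (suc m)
    g = eval (seg {suc m} (suc s) (suc m)) · ι h
    g-last : ⟦ g ⟧ (suc m) ≡ s
    g-last = trans (⟦⟧-seg·ι s≤m h (suc m)) (trans (cong (cycle s (suc m)) (⟦⟧-beyond h ≤-refl)) (cycle-top s (suc m)))
    monotone : ∀ {p q} → q < suc m → ⟦ h ⟧ p < ⟦ h ⟧ q → ⟦ g ⟧ p < ⟦ g ⟧ q
    monotone q<1+m lt = subst₂ _<_ (sym (⟦⟧-seg·ι s≤m h _)) (sym (⟦⟧-seg·ι s≤m h _)) (cycle-monotone-below lt (⟦⟧-< h q<1+m))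
    reflects : ∀ {p q} → p < suc m → q < suc m → ⟦ g ⟧ p < ⟦ g ⟧ q → ⟦ h ⟧ p < ⟦ h ⟧ q
    reflects p<1+m q<1+m lt =
      cycle-reflects-<-below (⟦⟧-< h p<1+m) (⟦⟧-< h q<1+m) (subst₂ _<_ (⟦⟧-seg·ι s≤m h _) (⟦⟧-seg·ι s≤m h _) lt)

  Avoids321-seg·ι⁻ : Avoids321 g → Avoids321 h × NoInversionAbove s (suc m) ⟦ h ⟧
  Avoids321-seg·ι⁻ avoids = avoids-h , no-inversion
    where
    avoids-h : Avoids321 h
    avoids-h p q r (p<q , q<r , r<1+m , fq<fp , fr<fq) =
      avoids p q r (p<q , q<r , m<n⇒m<1+n r<1+m , monotone (<-trans p<q (<-trans q<r r<1+m)) fq<fp , monotone (<-trans q<r r<1+m) fr<fq)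
    no-inversion : NoInversionAbove s (suc m) ⟦ h ⟧
    no-inversion {p} {q} p<q q<1+m s≤hq hq<hp = avoids p q (suc m) (p<q , q<1+m , ≤-refl , monotone (<-trans p<q q<1+m) hq<hp ,
      subst₂ _<_ (sym g-last) (sym (⟦⟧-seg·ι s≤m h q)) (subst (s <_) (sym (cycle-inside s≤hq (⟦⟧-< h q<1+m))) (s≤s s≤hq)))

  Avoids321-seg·ι : Avoids321 h → NoInversionAbove s (suc m) ⟦ h ⟧ → Avoids321 g
  Avoids321-seg·ι avoids no-inversion p q r (p<q , q<r , r<2+m , gq<gp , gr<gq) with m≤n⇒m<n∨m≡n (s≤s⁻¹ r<2+m)
  ... | inj₁ r<1+m = avoids p q r
    (p<q , q<r , r<1+m , reflects (<-trans q<r r<1+m) (<-trans p<q (<-trans q<r r<1+m)) gq<gp , reflects r<1+m (<-trans q<r r<1+m) gr<gq)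
  ... | inj₂ refl = no-inversion p<q q<r s≤hq (reflects q<r (<-trans p<q q<r) gq<gp)
    where
    s≤hq : s ≤ ⟦ h ⟧ q
    s≤hq with ⟦ h ⟧ q <? s
    ... | no hq≮s = ≮⇒≥ hq≮s
    ... | yes hq<s = ⊥-elim (<-asym hq<s (subst₂ _<_ g-last
                       (trans (⟦⟧-seg·ι s≤m h q) (cycle-below (<⇒≢ (⟦⟧-< h q<r)) hq<s)) gr<gq))

-- Pairs are 1-based, as in the paper: (i , j) stands for [i, j], acting as cycle (i ∸ 1) j.
⟦_⟧ᶜ : List (ℕ × ℕ) → ℕ → ℕ
⟦ [] ⟧ᶜ x = x
⟦ (i , j) ∷ cs ⟧ᶜ x = cycle (i ∸ 1) j (⟦ cs ⟧ᶜ x)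

⟦⟧-canonWord : ∀ {n} cs → All (ValidPair n) cs → ∀ x → ⟦ eval (canonWord {n} cs) ⟧ x ≡ ⟦ cs ⟧ᶜ x
⟦⟧-canonWord {n} cs valid x = trans (⟦⟧-eval (canonWord cs) x) (⟦⟧ʷ-canonWord cs valid)
  where
  ⟦⟧ʷ-canonWord : ∀ cs → All (ValidPair n) cs → ⟦ canonWord {n} cs ⟧ʷ x ≡ ⟦ cs ⟧ᶜ x
  ⟦⟧ʷ-canonWord [] [] = refl
  ⟦⟧ʷ-canonWord ((suc s , j) ∷ cs) ((_ , s<j , j≤n) ∷ valid) = trans (⟦⟧ʷ-++ (seg {n} (suc s) j) (canonWord cs) x)
    (trans (⟦⟧ʷ-seg (<⇒≤ s<j) j≤n _) (cong (cycle s j) (⟦⟧ʷ-canonWord cs valid)))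

ValidPair-weaken : ∀ {m} {cs} → All (ValidPair m) cs → All (ValidPair (suc m)) cs
ValidPair-weaken = All.map λ { {_ , _} (1≤i , i≤j , j≤m) → 1≤i , i≤j , m≤n⇒m≤1+n j≤m }

ValidPair-strengthen : ∀ {m} {cs} → All (ValidPair (suc m)) cs → All ((_< suc m) ∘ proj₂) cs → All (ValidPair m) cs
ValidPair-strengthen [] [] = []
ValidPair-strengthen ((1≤i , i≤j , _) ∷ valid) (j<1+m ∷ bounded) = (1≤i , i≤j , s≤s⁻¹ j<1+m) ∷ ValidPair-strengthen valid bounded

canonWord-ι : ∀ {m} cs → All (ValidPair m) cs → eval (canonWord {suc m} cs) ≡ ι (eval (canonWord {m} cs))
canonWord-ι cs valid = Elt-ext λ x _ →
  trans (⟦⟧-canonWord cs (ValidPair-weaken valid) x) (sym (trans (⟦⟧-ι _ x) (⟦⟧-canonWord cs valid x)))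

canonWord-seg·ι : ∀ {m} s cs → All (ValidPair m) cs →
  eval (canonWord {suc m} ((suc s , suc m) ∷ cs)) ≡ eval (seg {suc m} (suc s) (suc m)) · ι (eval (canonWord {m} cs))
canonWord-seg·ι {m} s cs valid =
  trans (eval-++ (seg (suc s) (suc m)) (canonWord cs)) (cong (eval (seg {suc m} (suc s) (suc m)) ·_) (canonWord-ι cs valid))

Decr⇒below : ∀ {k j} cs → Decr ((k , j) ∷ cs) → All ((_< j) ∘ proj₂) cs
Decr⇒below [] _ = []
Decr⇒below ((k' , j') ∷ cs) (_ , j'<j , decr) = j'<j ∷ All.map (λ j''<j' → <-trans j''<j' j'<j) (Decr⇒below cs decr)

Canonical-strengthen : ∀ {m i j cs} → Canonical (suc m) ((i , j) ∷ cs) → j ≤ m → Canonical m ((i , j) ∷ cs)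
Canonical-strengthen {cs = cs} (valid , decr) j≤m =
  ValidPair-strengthen valid (s≤s j≤m ∷ All.map (λ j'<j → <-trans j'<j (s≤s j≤m)) (Decr⇒below cs decr)) , decr

⟦⟧ᶜ-beyond : ∀ {j} cs → All ((_< j) ∘ proj₂) cs → ∀ {x} → j ≤ x → ⟦ cs ⟧ᶜ x ≡ x
⟦⟧ᶜ-beyond [] [] _ = refl
⟦⟧ᶜ-beyond ((i' , j') ∷ cs) (j'<j ∷ bounded) j≤x =
  trans (cong (cycle (i' ∸ 1) j') (⟦⟧ᶜ-beyond cs bounded j≤x)) (cycle-above (<-≤-trans j'<j j≤x))

CanonicalForm : ∀ n → ℕ → Elt n → Set
CanonicalForm n i g = ∃ λ j → ∃ λ cs → Canonical n ((i , j) ∷ cs) × eval (canonWord {n} ((i , j) ∷ cs)) ≡ g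

CanonicalForm-ι : ∀ {m i} {h : Elt m} → CanonicalForm m i h → CanonicalForm (suc m) i (ι h)
CanonicalForm-ι (j , cs , (valid , decr) , refl) = j , cs , (ValidPair-weaken valid , decr) , canonWord-ι _ valid

CanonicalForm-seg·ι-one : ∀ {m s} → s ≤ m → CanonicalForm (suc m) (suc s) (eval (seg {suc m} (suc s) (suc m)) · ι one)
CanonicalForm-seg·ι-one {m} {s} s≤m =
  suc m , [] , ((s≤s z≤n , s≤s s≤m , ≤-refl) ∷ [] , tt) , canonWord-seg·ι s [] []

CanonicalForm-seg·ι : ∀ {m s k} {h : Elt m} → s ≤ m → k < s → CanonicalForm m (suc k) h →
  CanonicalForm (suc m) (suc s) (eval (seg {suc m} (suc s) (suc m)) · ι h)
CanonicalForm-seg·ι {m} {s} {k} s≤m k<s (j , cs , (valid@((_ , _ , j≤m) ∷ _) , decr) , refl) =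
  suc m , (suc k , j) ∷ cs , ((s≤s z≤n , s≤s s≤m , ≤-refl) ∷ ValidPair-weaken valid , (s≤s k<s , s≤s j≤m , decr)) ,
  canonWord-seg·ι s ((suc k , j) ∷ cs) valid

-- Later pairs start below k (Decr), so only the first cycle can create an inversion at values ≥ k.
⟦⟧ᶜ-NoInversionAbove : ∀ {m k j cs} → Canonical m ((k , j) ∷ cs) → ∀ {N} → NoInversionAbove k N ⟦ (k , j) ∷ cs ⟧ᶜ
⟦⟧ᶜ-NoInversionAbove {k = zero} (((() , _) ∷ _) , _)
⟦⟧ᶜ-NoInversionAbove {k = suc s} {cs = []} _ p<q _ k≤q lt = <-asym lt (cycle-increasing-above p<q k≤q)
⟦⟧ᶜ-NoInversionAbove {k = suc s} {cs = (k' , j') ∷ cs} ((_ ∷ valid) , (k'<k , _ , decr)) p<q q<N k≤q lt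
  with cycle-inversion-above k≤q lt
... | s≤b , b<a = ⟦⟧ᶜ-NoInversionAbove (valid , decr) p<q q<N (≤-trans (s≤s⁻¹ k'<k) s≤b) b<a

-- The first pair (k , j) sends j to k − 1 and some p < j to j: an inversion whose smaller value is k − 1.
CanonicalForm-first-index : ∀ {m k s} {h : Elt m} → CanonicalForm m (suc k) h → NoInversionAbove s (suc m) ⟦ h ⟧ → k < s
CanonicalForm-first-index {m} {k} {s} {h} (j , cs , (valid@((_ , k<j , j≤m) ∷ _) , decr) , refl) no-inversion with k <? s
... | yes k<s = k<s
... | no k≮s = ⊥-elim (no-inversion p<j (s≤s j≤m) (subst (s ≤_) (sym hj≡k) (≮⇒≥ k≮s)) (subst₂ _<_ (sym hj≡k) (sym hp≡j) k<j))
  where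
  L : List (ℕ × ℕ)
  L = (suc k , j) ∷ cs
  ⟦L⟧-j : ⟦ L ⟧ᶜ j ≡ k
  ⟦L⟧-j = trans (cong (cycle k j) (⟦⟧ᶜ-beyond cs (Decr⇒below cs decr) ≤-refl)) (cycle-top k j)
  p : ℕ
  p = ⟦ reverse (canonWord {m} L) ⟧ʷ j
  ⟦L⟧-p : ⟦ L ⟧ᶜ p ≡ j
  ⟦L⟧-p = trans (sym (trans (sym (⟦⟧-eval (canonWord {m} L) p)) (⟦⟧-canonWord L valid p))) (⟦⟧ʷ-reverse-inverseʳ (canonWord {m} L) j)
  hj≡k : ⟦ h ⟧ j ≡ k
  hj≡k = trans (⟦⟧-canonWord L valid j) ⟦L⟧-j
  hp≡j : ⟦ h ⟧ p ≡ j
  hp≡j = trans (⟦⟧-canonWord L valid p) ⟦L⟧-p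
  p<j : p < j
  p<j with <-cmp p j
  ... | tri< p<j _ _ = p<j
  ... | tri≈ _ p≡j _ = ⊥-elim (<-irrefl (trans (sym ⟦L⟧-j) (trans (cong ⟦ L ⟧ᶜ (sym p≡j)) ⟦L⟧-p)) k<j)
  ... | tri> _ _ j<p = ⊥-elim (<-irrefl (trans (sym ⟦L⟧-p) (trans (cong (cycle k j) (⟦⟧ᶜ-beyond cs (Decr⇒below cs decr) (<⇒≤ j<p)))
                                                              (cycle-above j<p))) j<p)

IsInjective-·⁻ : ∀ {n} {g h : Elt n} → IsInjective (g · h) → IsInjective h
IsInjective-·⁻ {g = g} {h} inj {x} {y} e = inj (trans (⟦⟧-· g h x) (trans (cong ⟦ g ⟧ e) (sym (⟦⟧-· g h y))))

Avoids321-one : ∀ {n} → Avoids321 (one {n})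
Avoids321-one p q r (p<q , _ , _ , fq<fp , _) = <-asym p<q (subst₂ _<_ (⟦⟧-one q) (⟦⟧-one p) fq<fp)

Elt-0 : ∀ (g : Elt 0) → g ≡ one
Elt-0 g = Elt-ext λ { zero _ → trans (n<1⇒n≡0 (⟦⟧-< g (s≤s z≤n))) (sym (⟦⟧-one 0)) ; (suc x) (s≤s ()) }

-- Induct on n: either g fixes n, so g = ι h, or g (n) = s < n and g = [s+1, n] · ι h, where
-- the canonical form of h must start below s+1 by CanonicalForm-first-index.
canonical-form : ∀ {n} (g : Elt n) → IsInjective g → Avoids321 g → g ≡ one ⊎ ∃ λ i → 1 ≤ i × i ≤ n × CanonicalForm n i g
canonical-form {zero} g _ _ = inj₁ (Elt-0 g)
canonical-form {suc m} g inj avoids with ⟦ g ⟧ (suc m) ≟ suc m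
... | yes fixes = fixed (fixes-last⇒ι g inj fixes)
  where
  fixed : (∃ λ h → g ≡ ι h) → g ≡ one ⊎ ∃ λ i → 1 ≤ i × i ≤ suc m × CanonicalForm (suc m) i g
  fixed (h , g≡ιh) with canonical-form h (IsInjective-ι⁻ {h = h} (subst IsInjective g≡ιh inj)) (Avoids321-ι⁻ h (subst Avoids321 g≡ιh avoids))
  ... | inj₁ h≡one = inj₁ (trans g≡ιh (trans (cong ι h≡one) ι-one))
  ... | inj₂ (i , 1≤i , i≤m , cf) = inj₂ (i , 1≤i , m≤n⇒m≤1+n i≤m , subst (CanonicalForm (suc m) i) (sym g≡ιh) (CanonicalForm-ι cf))
... | no moves = moved gm≤m (seg·ι-decomposition gm≤m g inj refl)
  where
  gm≤m : ⟦ g ⟧ (suc m) ≤ m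
  gm≤m = s≤s⁻¹ (≤∧≢⇒< (s≤s⁻¹ (⟦⟧-< g ≤-refl)) moves)
  moved : ∀ {s} (s≤m : s ≤ m) → (∃ λ h → g ≡ eval (seg {suc m} (suc s) (suc m)) · ι h) →
    g ≡ one ⊎ ∃ λ i → 1 ≤ i × i ≤ suc m × CanonicalForm (suc m) i g
  moved {s} s≤m (h , g≡S·ιh) with Avoids321-seg·ι⁻ s≤m h (subst Avoids321 g≡S·ιh avoids)
  ... | avoids-h , no-inversion with canonical-form h (IsInjective-ι⁻ {h = h} (IsInjective-·⁻ {g = eval (seg {suc m} (suc s) (suc m))} (subst IsInjective g≡S·ιh inj))) avoids-h
  ...   | inj₁ h≡one = inj₂ (suc s , s≤s z≤n , s≤s s≤m ,
    subst (CanonicalForm (suc m) (suc s)) (sym (trans g≡S·ιh (cong (λ z → eval (seg {suc m} (suc s) (suc m)) · ι z) h≡one))) (CanonicalForm-seg·ι-one s≤m))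
  ...   | inj₂ (zero , () , _)
  ...   | inj₂ (suc k , _ , _ , cf) = inj₂ (suc s , s≤s z≤n , s≤s s≤m ,
    subst (CanonicalForm (suc m) (suc s)) (sym g≡S·ιh) (CanonicalForm-seg·ι s≤m (CanonicalForm-first-index cf no-inversion) cf))

iA-suc : ∀ {n i} {g : Elt n} → FC g → CanonicalForm n (suc i) g → iA n (suc i) g
iA-suc fc (j , cs , canonical , ev) = fc , (j , cs) , canonical , ev

iA-suc⁻ : ∀ {n i} {g : Elt n} → iA n (suc i) g → FC g × CanonicalForm n (suc i) g
iA-suc⁻ (fc , (j , cs) , canonical , ev) = fc , j , cs , canonical , ev

FC-ι : ∀ {m} {h : Elt m} → FC h → FC (ι h)
FC-ι {h = h} fc = Avoids321⇒FC (ι h) (IsInjective-ι {h = h} (InW⇒injective (proj₁ fc))) (Avoids321-ι h (FC⇒Avoids321 h fc))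

FC-seg·ι : ∀ {m s} {h : Elt m} (s≤m : s ≤ m) → FC h → NoInversionAbove s (suc m) ⟦ h ⟧ →
  FC (eval (seg {suc m} (suc s) (suc m)) · ι h)
FC-seg·ι {m} {s} {h} s≤m fc no-inversion =
  Avoids321⇒FC (eval S · ι h) (IsInjective-· {g = eval S} (eval-injective S) (IsInjective-ι (InW⇒injective (proj₁ fc))))
    (Avoids321-seg·ι s≤m h (FC⇒Avoids321 h fc) no-inversion)
  where S = seg {suc m} (suc s) (suc m)

top-decomposition : ∀ {m s} → s ≤ m → (g : Elt (suc m)) → FC g → ∀ cs → Canonical (suc m) ((suc s , suc m) ∷ cs) →
  eval (canonWord {suc m} ((suc s , suc m) ∷ cs)) ≡ g →
  ∃ λ k → k < suc s × ∃ λ h → iA m k h × g ≡ eval (seg {suc m} (suc s) (suc m)) · ι h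
top-decomposition {m} {s} s≤m g fc [] _ ev = 0 , s≤s z≤n , one , refl , trans (sym ev) (canonWord-seg·ι s [] [])
top-decomposition s≤m g fc ((zero , _) ∷ _) ((_ ∷ (() , _) ∷ _) , _) ev
top-decomposition {m} {s} s≤m g fc ((suc k , j) ∷ cs) ((_ ∷ valid@((_ , _ , j≤1+m) ∷ _)) , (k<s , j<1+m , decr)) ev =
  suc k , k<s , h , iA-suc fc-h (j , cs , canonical-m , refl) , g≡S·ιh
  where
  canonical-m : Canonical m ((suc k , j) ∷ cs)
  canonical-m = Canonical-strengthen (valid , decr) (s≤s⁻¹ j<1+m)
  h : Elt m
  h = eval (canonWord {m} ((suc k , j) ∷ cs))
  g≡S·ιh : g ≡ eval (seg {suc m} (suc s) (suc m)) · ι h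
  g≡S·ιh = trans (sym ev) (canonWord-seg·ι s _ (proj₁ canonical-m))
  fc-h : FC h
  fc-h = Avoids321⇒FC h (eval-injective (canonWord {m} ((suc k , j) ∷ cs))) (proj₁ (Avoids321-seg·ι⁻ s≤m h (subst Avoids321 g≡S·ιh (FC⇒Avoids321 g fc))))

-- Either j₁ ≤ m and the canonical form lives in W(A_m), or j₁ = m+1 and it is [s+1, m+1] followed
-- by a canonical form of W(A_m) with first index k < s+1 (k = 0 for the empty one).
decomposition : ∀ {m s} (g : Elt (suc m)) → s ≤ m → iA (suc m) (suc s) g →
  (∃ λ h → iA m (suc s) h × g ≡ ι h) ⊎ (∃ λ k → k < suc s × ∃ λ h → iA m k h × g ≡ eval (seg {suc m} (suc s) (suc m)) · ι h)
decomposition {m} {s} g s≤m (fc , (j , cs) , canonical@(((_ , _ , j≤1+m) ∷ _) , _) , ev) with m≤n⇒m<n∨m≡n j≤1+m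
... | inj₂ refl = inj₂ (top-decomposition s≤m g fc cs canonical ev)
... | inj₁ j<1+m = inj₁ (h , iA-suc fc-h (j , cs , canonical-m , refl) , g≡ιh)
  where
  canonical-m : Canonical m ((suc s , j) ∷ cs)
  canonical-m = Canonical-strengthen canonical (s≤s⁻¹ j<1+m)
  h : Elt m
  h = eval (canonWord {m} ((suc s , j) ∷ cs))
  g≡ιh : g ≡ ι h
  g≡ιh = trans (sym ev) (canonWord-ι _ (proj₁ canonical-m))
  fc-h : FC h
  fc-h = Avoids321⇒FC h (eval-injective (canonWord {m} ((suc s , j) ∷ cs))) (Avoids321-ι⁻ h (subst Avoids321 g≡ιh (FC⇒Avoids321 g fc)))

recomposition : ∀ {m s} (g : Elt (suc m)) → s ≤ m →
  (∃ λ h → iA m (suc s) h × g ≡ ι h) ⊎ (∃ λ k → k < suc s × ∃ λ h → iA m k h × g ≡ eval (seg {suc m} (suc s) (suc m)) · ι h) →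
  iA (suc m) (suc s) g
recomposition {m} {s} g s≤m (inj₁ (h , ih , g≡ιh)) with iA-suc⁻ ih
... | fc , cf = subst (iA (suc m) (suc s)) (sym g≡ιh) (iA-suc (FC-ι fc) (CanonicalForm-ι cf))
recomposition {m} {s} g s≤m (inj₂ (zero , _ , h , h≡one , g≡S·ιh)) =
  subst (iA (suc m) (suc s)) (sym (trans g≡S·ιh (cong (λ z → eval (seg {suc m} (suc s) (suc m)) · ι z) h≡one)))
    (iA-suc (FC-seg·ι s≤m (Avoids321⇒FC one (eval-injective []) Avoids321-one) (NoInversionAbove-one _ _)) (CanonicalForm-seg·ι-one s≤m))
recomposition {m} {s} g s≤m (inj₂ (suc k , s≤s k<s , h , ih , g≡S·ιh)) with iA-suc⁻ ih
... | fc , cf@(j , cs , canonical@(valid , _) , ev) =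
  subst (iA (suc m) (suc s)) (sym g≡S·ιh) (iA-suc (FC-seg·ι s≤m fc no-inversion) (CanonicalForm-seg·ι s≤m k<s cf))
  where
  no-inversion : NoInversionAbove s (suc m) ⟦ h ⟧
  no-inversion = NoInversionAbove-weaken k<s (NoInversionAbove-cong
    (λ x → sym (trans (cong (λ z → ⟦ z ⟧ x) (sym ev)) (⟦⟧-canonWord _ valid x))) (⟦⟧ᶜ-NoInversionAbove canonical))

mainTheorem9 : (m : ℕ) →
    (∀ (g : Elt (suc m)) →
      Ac (suc m) g ⇔ (g ≡ one ⊎ ∃ λ i → 1 ≤ i × i ≤ suc m × iA (suc m) i g))
    × (∀ (i : ℕ) → 1 ≤ i → i ≤ suc m → ∀ (g : Elt (suc m)) →
      iA (suc m) i g ⇔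
        ((∃ λ h → iA m i h × g ≡ ι h)
         ⊎ (∃ λ k → k < i × ∃ λ h → iA m k h × g ≡ eval (seg {suc m} i (suc m)) · ι h)))
mainTheorem9 m = (λ g → mk⇔ (FC⇒one-or-iA g) (one-or-iA⇒FC g)) , λ
  { zero () _ _
  ; (suc s) _ 1+s≤1+m g → mk⇔ (decomposition g (s≤s⁻¹ 1+s≤1+m)) (recomposition g (s≤s⁻¹ 1+s≤1+m)) }
  where
  FC⇒one-or-iA : ∀ g → Ac (suc m) g → g ≡ one ⊎ ∃ λ i → 1 ≤ i × i ≤ suc m × iA (suc m) i g
  FC⇒one-or-iA g fc with canonical-form g (InW⇒injective (proj₁ fc)) (FC⇒Avoids321 g fc)
  ... | inj₁ g≡one = inj₁ g≡one
  ... | inj₂ (zero , () , _)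
  ... | inj₂ (suc i , 1≤i , i≤1+m , cf) = inj₂ (suc i , 1≤i , i≤1+m , iA-suc fc cf)
  one-or-iA⇒FC : ∀ g → (g ≡ one ⊎ ∃ λ i → 1 ≤ i × i ≤ suc m × iA (suc m) i g) → Ac (suc m) g
  one-or-iA⇒FC g (inj₁ refl) = Avoids321⇒FC one (eval-injective []) Avoids321-one
  one-or-iA⇒FC g (inj₂ (zero , () , _))
  one-or-iA⇒FC g (inj₂ (suc i , _ , _ , fc , _)) = fc
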